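{- Let $T$ be a tree of order $n\ge 6$, with bipartition classes $X,Y$, $|X|\le|Y|$, and let $d_1\ge d_2\ge\dots\ge d_{2^{n-2}}$ be the degree sequence of $\mathcal{B}_3(T)$. Then: (i) $T$ is the star $K_{1,n-1}$ if and only if $d_1=d_{2^{n-2}}$; (ii) $T$ is a double broom (equivalently $|X|=2$) if and only if $d_1=d_2>d_{2^{n-2}}$; (iii) $|X|\ge 3$ if and only if $d_1>d_2$.
   Context: A stable $k$-partition of a graph $G$ is a multiset of $k$ independent sets of $G$ (some possibly empty) partitioning $V(G)$; for $v\in V(G)$, $P-v$ is obtained by deleting $v$ from its part. The Bell $k$-coloring graph $\mathcal{B}_k(G)$ has vertex set the stable $k$-partitions of $G$, with distinct $P,Q$ adjacent iff $P-v=Q-v$ for some $v$; for a tree of order $n$, $\mathcal{B}_3(T)$ has $2^{n-2}$ vertices. A double broom $B(3,a,b)$ (nonnegative integers $a\ge b$) is the tree obtained from a path $u$–$v$–$w$ by attaching $a$ leaves to $u$ and $b$ leaves to $w$; a tree is a double broom exactly when its smaller bipartition class has size $2$. -}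

module Defs where

open import Data.Bool using (Bool; true; false; _∧_; _∨_; not; if_then_else_)
open import Data.Nat using (ℕ; zero; suc; _+_; _≤_; _<_; _⊔_; _⊓_)
open import Data.Nat.Properties using (≤-decTotalOrder)
open import Data.Fin using (Fin; zero; suc; inject₁; fromℕ; toℕ; _≟_)
open import Data.Fin.Properties using () renaming (_≟_ to _≟F_)
open import Data.List using (List; []; _∷_; map; filter; length; reverse; concatMap; allFin)
open import Data.Bool.ListAction using (all; any)
open import Data.Product using (Σ; ∃; ∃-syntax; _×_; _,_)
open import Data.Sum using (_⊎_)
open import Relation.Binary.PropositionalEquality using (_≡_; _≢_)
open import Relation.Nullary using (¬_; does)
open import Function.Definitions using (Injective)
open import Data.List.Sort.MergeSort ≤-decTotalOrder using (sort)

record Graph (n : ℕ) : Set where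
  field
    adj   : Fin n → Fin n → Bool
    sym   : ∀ u v → adj u v ≡ adj v u
    irrefl : ∀ v → adj v v ≡ false
open Graph public

Adj : ∀ {n} → Graph n → Fin n → Fin n → Set
Adj G u v = adj G u v ≡ true

Connected : ∀ {n} → Graph n → Set
Connected {n} G = ∀ x y → ∃[ k ] Σ (Fin (suc k) → Fin n) λ p →
  (p zero ≡ x) × (p (fromℕ k) ≡ y) × (∀ (i : Fin k) → Adj G (p (inject₁ i)) (p (suc i)))

HasCycle : ∀ {n} → Graph n → Set
HasCycle {n} G = ∃[ k ] Σ (Fin (suc (suc (suc k))) → Fin n) λ c →
  Injective _≡_ _≡_ c ×
  (∀ (i : Fin (suc (suc k))) → Adj G (c (inject₁ i)) (c (suc i))) ×
  Adj G (c (fromℕ (suc (suc k)))) (c zero)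

IsTree : ∀ {n} → Graph n → Set
IsTree G = Connected G × ¬ HasCycle G

IsStar : ∀ {n} → Graph n → Set
IsStar {n} G = ∃[ c ] (∀ v → v ≢ c → Adj G c v)

-- the double broom B(3,a,b): a path u–v–w, v has no other neighbours,
-- and every other vertex is a leaf attached to u or to w
-- (a and b are the numbers of leaves at u and w; the roles of u,w can
-- be swapped so a ≥ b is no restriction)
IsDoubleBroom : ∀ {n} → Graph n → Set
IsDoubleBroom {n} G = Σ (Fin n) λ u → Σ (Fin n) λ v → Σ (Fin n) λ w →
  (u ≢ w) × Adj G u v × Adj G v w ×
  (∀ y → Adj G v y → (y ≡ u) ⊎ (y ≡ w)) ×
  (∀ x → x ≢ u → x ≢ v → x ≢ w →
     (Adj G x u × (∀ y → Adj G x y → y ≡ u)) ⊎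
     (Adj G x w × (∀ y → Adj G x y → y ≡ w)))

-- Bipartition: a proper 2-colouring side : Fin n → Bool.
-- The classes are {side = true} and {side = false}.

ProperSides : ∀ {n} → Graph n → (Fin n → Bool) → Set
ProperSides G s = ∀ u v → Adj G u v → s u ≢ s v

count : ∀ {n} → (Fin n → Bool) → ℕ
count {n} p = length (filter (λ x → p x Data.Bool.≟ true) (allFin n))

smallClass : ∀ {n} → (Fin n → Bool) → ℕ
smallClass s = count s ⊓ count (λ x → not (s x))

-- A multiset of 3 independent sets partitioning V
-- (some possibly empty) is the same as a set partition of V into at most
-- 3 blocks, each independent.  We represent each such partition by its
-- unique canonical colouring c : Fin n → Fin 3 (restricted growth string:
-- colour i is used only after colours 0,…,i-1 have appeared, reading the
-- vertices in order 0,1,…,n-1).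

Col : ℕ → Set
Col n = Fin n → Fin 3

allCols : ∀ n → List (Col n)
allCols zero = (λ ()) ∷ []
allCols (suc n) = concatMap (λ a → map (λ c → λ { zero → a ; (suc i) → c i }) (allCols n)) (allFin 3)

-- restricted growth check; m = number of colours used so far
rgFrom : ℕ → List (Fin 3) → Bool
rgFrom m [] = true
rgFrom m (a ∷ as) = (toℕ a Data.Nat.<ᵇ suc m) ∧ rgFrom (m ⊔ suc (toℕ a)) as

canonical : ∀ {n} → Col n → Bool
canonical {n} c = rgFrom 0 (map c (allFin n))

_==F_ : ∀ {k} → Fin k → Fin k → Bool
a ==F b = does (a ≟F b)

properB : ∀ {n} → Graph n → Col n → Bool
properB {n} G c = all (λ u → all (λ v → not (adj G u v ∧ (c u ==F c v))) (allFin n)) (allFin n)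

stablePartitions : ∀ {n} → Graph n → List (Col n)
stablePartitions {n} G = filter (λ c → (properB G c ∧ canonical c) Data.Bool.≟ true) (allCols n)

_==B_ : Bool → Bool → Bool
true ==B b = b
false ==B b = not b

-- P - v = Q - v : the partitions of V ∖ {v} induced by P and Q coincide,
-- i.e. same "same block" relation on V ∖ {v}
sameMinus : ∀ {n} → Fin n → Col n → Col n → Bool
sameMinus {n} v P Q = all (λ x → all (λ y →
  (x ==F v) ∨ (y ==F v) ∨ ((P x ==F P y) ==B (Q x ==F Q y))) (allFin n)) (allFin n)

samePartition : ∀ {n} → Col n → Col n → Bool
samePartition {n} P Q = all (λ x → all (λ y → (P x ==F P y) ==B (Q x ==F Q y)) (allFin n)) (allFin n)

bellAdj : ∀ {n} → Col n → Col n → Bool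
bellAdj {n} P Q = not (samePartition P Q) ∧ any (λ v → sameMinus v P Q) (allFin n)

bellDegree : ∀ {n} → Graph n → Col n → ℕ
bellDegree G P = length (filter (λ Q → bellAdj P Q Data.Bool.≟ true) (stablePartitions G))

degreeSequence : ∀ {n} → Graph n → List ℕ
degreeSequence G = reverse (sort (map (bellDegree G) (stablePartitions G)))

-- 1-based indexing d_i (0 if out of range)
nth : List ℕ → ℕ → ℕ
nth [] _ = 0
nth (x ∷ xs) zero = 0
nth (x ∷ xs) (suc zero) = x
nth (x ∷ xs) (suc (suc i)) = nth xs (suc i)

d : ∀ {n} → Graph n → ℕ → ℕ
d G i = nth (degreeSequence G) i

{-# OPTIONS --safe #-}
module Submission where

-- Stable 3-partitions are represented by their canonical (restricted
-- growth) proper 3-colourings; deleting leaves one at a time shows that a tree on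
-- n vertices has 3·2^(n-1) proper colourings and hence 2^(n-2) stable partitions.
-- A neighbour of P in B₃(T) arises by moving a single vertex v to another block.
-- If v has a neighbour this is possible in at most one way, and in none at all when
-- v is adjacent to every other vertex or sees two blocks among its neighbours
-- ("v is frozen"); so deg P ≤ n − #frozen vertices, while explicit moves give lower
-- bounds.  Every stable partition other than the bipartition {X, Y} has a frozen
-- vertex.  Hence: in a star every degree is n − 1; if |X| ≥ 3 the bipartition is the
-- unique partition of degree n; in a double broom all degrees are at most n − 1, the
-- bipartition and the one isolating a leaf attain n − 1, and a partition with two
-- frozen vertices has degree at most n − 2.

open import Defs hiding (sym)
open import Data.Bool as Bool using (Bool; true; false; _∧_; _∨_; not; if_then_else_)
import Data.Bool.Properties as BoolP
open import Data.Empty using (⊥; ⊥-elim)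
open import Data.Fin as Fin using (Fin; zero; suc; toℕ; punchIn; punchOut; inject₁; fromℕ)
open import Data.Fin.Properties as FinP using (all?; any?; punchIn-injective; punchInᵢ≢i; punchIn-punchOut)
open import Data.Fin.Patterns using (0F; 1F; 2F)
open import Data.Fin.Permutation using (Permutation; _⟨$⟩ʳ_; _⟨$⟩ˡ_; transpose; inverseˡ)
open import Data.List as List using (List; []; _∷_; map; filter; length; allFin; tabulate; _++_)
import Data.List.Properties as ListP
open import Data.Bool.ListAction using (all; any)
open import Data.List.Relation.Unary.All as All using (All; []; _∷_)
import Data.List.Relation.Unary.All.Properties as AllP
import Data.List.Relation.Unary.Any.Properties as AnyP
open import Data.List.Membership.Propositional.Properties using (∈-lookup)
open import Data.List.Relation.Unary.Unique.Propositional using (Unique)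
open import Data.List.Relation.Unary.AllPairs using (AllPairs; []; _∷_)
open import Data.List.Relation.Unary.Linked.Properties using (Linked⇒AllPairs)
open import Data.List.Relation.Binary.Permutation.Propositional using (_↭_; ↭-trans)
open import Data.List.Relation.Binary.Permutation.Propositional.Properties using (↭-reverse; filter-↭; ↭-length)
open import Data.Nat
open import Data.Nat.Properties
open import Data.Nat.Induction using (<-rec)
open import Algebra.Properties.CommutativeMonoid.Sum +-0-commutativeMonoid
  using (sum; sum-cong-≗; ∑-distrib-+; ∑-comm; ∑-permute)
open import Data.List.Sort.MergeSort ≤-decTotalOrder using (sort)
open import Data.List.Sort.MergeSort.Properties ≤-decTotalOrder using (sort-↭; sort-↗)
open import Data.Product using (Σ; ∃; _×_; _,_; proj₁; proj₂)
open import Data.Sum using (_⊎_; inj₁; inj₂; [_,_]′)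
open import Data.Vec.Functional using (insertAt; updateAt)
open import Data.Vec.Functional.Properties using (insertAt-lookup; insertAt-punchIn; updateAt-updates; updateAt-minimal)
open import Function using (_∘_; id; case_of_)
open import Function.Bundles using (_⇔_; mk⇔; Equivalence)
import Function.Properties.Equivalence as ⇔
open import Relation.Binary.PropositionalEquality
open import Relation.Nullary using (¬_; Dec; yes; no)
open import Relation.Binary.Definitions using (tri<; tri≈; tri>)
open import Relation.Nullary.Decidable using (dec-true; dec-false; decidable-stable; toWitness; ¬?; _→-dec_; _×-dec_; _⊎-dec_)
open import Data.Unit using (tt)

open Equivalence using (to; from)

𝟙 : Bool → ℕ
𝟙 true = 1
𝟙 false = 0

𝟙≤1 : ∀ b → 𝟙 b ≤ 1
𝟙≤1 true = ≤-refl
𝟙≤1 false = z≤n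

𝟙-mono : ∀ {a b} → (a ≡ true → b ≡ true) → 𝟙 a ≤ 𝟙 b
𝟙-mono {false} h = z≤n
𝟙-mono {true} h rewrite h refl = ≤-refl

𝟙-pos : ∀ {b} → 1 ≤ 𝟙 b → b ≡ true
𝟙-pos {true} _ = refl

∧-true₁ : ∀ {a b} → (a ∧ b) ≡ true → a ≡ true
∧-true₁ {a} {b} = BoolP.∧-conicalˡ a b

∧-true₂ : ∀ {a b} → (a ∧ b) ≡ true → b ≡ true
∧-true₂ {a} {b} = BoolP.∧-conicalʳ a b

∧-intro : ∀ {a b} → a ≡ true → b ≡ true → (a ∧ b) ≡ true
∧-intro refl refl = refl

not-true⇒false : ∀ {a} → not a ≡ true → a ≡ false
not-true⇒false {a} = BoolP.not-injective {a} {false}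

¬true⇒false : ∀ {a} → ¬ (a ≡ true) → a ≡ false
¬true⇒false = BoolP.¬-not

true≢false : ∀ {a} → a ≡ true → a ≢ false
true≢false refl ()

∨-true⇒ : ∀ a {b} → (a ∨ b) ≡ true → a ≡ true ⊎ b ≡ true
∨-true⇒ true _ = inj₁ refl
∨-true⇒ false e = inj₂ e

≢-≢⇒≡ : ∀ {a b c : Bool} → a ≢ c → b ≢ c → a ≡ b
≢-≢⇒≡ a≢c b≢c = trans (BoolP.¬-not a≢c) (sym (BoolP.¬-not b≢c))

∧-congˡ-under : ∀ {a b c} → (a ≡ true → b ≡ c) → (a ∧ b) ≡ (a ∧ c)
∧-congˡ-under {false} _ = refl
∧-congˡ-under {true} h = h refl

∧-absorbˡ-under : ∀ {a b} → (b ≡ true → a ≡ true) → (a ∧ b) ≡ b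
∧-absorbˡ-under {a} {false} _ = BoolP.∧-zeroʳ a
∧-absorbˡ-under {a} {true} h = trans (BoolP.∧-identityʳ a) (h refl)

∧-absorbʳ-under : ∀ {a b} → (a ≡ true → b ≡ true) → (a ∧ b) ≡ a
∧-absorbʳ-under {false} _ = refl
∧-absorbʳ-under {true} h = h refl

bool-ext : ∀ {a b} → (a ≡ true → b ≡ true) → (b ≡ true → a ≡ true) → a ≡ b
bool-ext {true} f _ = sym (f refl)
bool-ext {false} {true} _ g = g refl
bool-ext {false} {false} _ _ = refl

==F-refl : ∀ {k} (a : Fin k) → (a ==F a) ≡ true
==F-refl a = dec-true (a Fin.≟ a) refl

≢⇒==F-false : ∀ {k} {a b : Fin k} → a ≢ b → (a ==F b) ≡ false
≢⇒==F-false {a = a} {b} = dec-false (a Fin.≟ b)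

==F⇒≡ : ∀ {k} {a b : Fin k} → (a ==F b) ≡ true → a ≡ b
==F⇒≡ {a = a} {b} e with a Fin.≟ b
... | yes p = p

==F-false⇒≢ : ∀ {k} {a b : Fin k} → (a ==F b) ≡ false → a ≢ b
==F-false⇒≢ {a = a} e refl = true≢false (==F-refl a) e

==B-refl : ∀ b → (b ==B b) ≡ true
==B-refl true = refl
==B-refl false = refl

==B⇒≡ : ∀ {a b} → (a ==B b) ≡ true → a ≡ b
==B⇒≡ {true} {true} _ = refl
==B⇒≡ {false} {false} _ = refl

≡⇒==B : ∀ {a b} → a ≡ b → (a ==B b) ≡ true
≡⇒==B {a} refl = ==B-refl a

≢⇒==B-false : ∀ {a b} → a ≢ b → (a ==B b) ≡ false
≢⇒==B-false {a} {b} ne = ¬true⇒false (ne ∘ ==B⇒≡)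

==B-cancelʳ : ∀ a b c → (a ==B c) ≡ (b ==B c) → a ≡ b
==B-cancelʳ true true c e = refl
==B-cancelʳ false false c e = refl
==B-cancelʳ true false true ()
==B-cancelʳ true false false ()
==B-cancelʳ false true true ()
==B-cancelʳ false true false ()

==B-not : ∀ a b → (not a ==B not b) ≡ (a ==B b)
==B-not true true = refl
==B-not true false = refl
==B-not false true = refl
==B-not false false = refl

==B-not-distribˡ : ∀ a b → (not a ==B b) ≡ not (a ==B b)
==B-not-distribˡ true b = refl
==B-not-distribˡ false b = sym (BoolP.not-involutive b)

==B-≡⇒⇔ : ∀ a b c d → (a ==B c) ≡ (b ==B d) → (a ≡ b) ⇔ (c ≡ d)
==B-≡⇒⇔ a b c d e = mk⇔ (λ { refl → ==B-cancelʳ c d a (trans (comm c a) (trans e (comm b d))) })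
                          (λ { refl → ==B-cancelʳ a b c e })
  where
  comm : ∀ x y → (x ==B y) ≡ (y ==B x)
  comm true true = refl
  comm true false = refl
  comm false true = refl
  comm false false = refl

tally : ∀ {A : Set} → (A → Bool) → List A → ℕ
tally p [] = 0
tally p (x ∷ xs) = 𝟙 (p x) + tally p xs

module _ {A : Set} where

  length-filter≡tally : ∀ (p : A → Bool) xs → length (filter (λ x → p x Bool.≟ true) xs) ≡ tally p xs
  length-filter≡tally p [] = refl
  length-filter≡tally p (x ∷ xs) with p x
  ... | true = cong suc (length-filter≡tally p xs)
  ... | false = length-filter≡tally p xs

  tally-filter : ∀ (p q : A → Bool) xs → tally q (filter (λ x → p x Bool.≟ true) xs) ≡ tally (λ x → p x ∧ q x) xs
  tally-filter p q [] = refl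
  tally-filter p q (x ∷ xs) with p x
  ... | true = cong (𝟙 (q x) +_) (tally-filter p q xs)
  ... | false = tally-filter p q xs

  tally-++ : ∀ (p : A → Bool) xs ys → tally p (xs ++ ys) ≡ tally p xs + tally p ys
  tally-++ p [] ys = refl
  tally-++ p (x ∷ xs) ys = trans (cong (𝟙 (p x) +_) (tally-++ p xs ys)) (sym (+-assoc (𝟙 (p x)) _ _))

  tally-map : ∀ {B : Set} (p : A → Bool) (g : B → A) xs → tally p (map g xs) ≡ tally (p ∘ g) xs
  tally-map p g [] = refl
  tally-map p g (x ∷ xs) = cong (𝟙 (p (g x)) +_) (tally-map p g xs)

  tally-cong : ∀ {p q : A → Bool} xs → (∀ x → p x ≡ q x) → tally p xs ≡ tally q xs
  tally-cong [] h = refl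
  tally-cong (x ∷ xs) h = cong₂ _+_ (cong 𝟙 (h x)) (tally-cong xs h)

  tally-mono : ∀ {p q : A → Bool} xs → (∀ x → p x ≡ true → q x ≡ true) → tally p xs ≤ tally q xs
  tally-mono [] h = z≤n
  tally-mono (x ∷ xs) h = +-mono-≤ (𝟙-mono (h x)) (tally-mono xs h)

  tally-≤-length : ∀ (p : A → Bool) xs → tally p xs ≤ length xs
  tally-≤-length p [] = z≤n
  tally-≤-length p (x ∷ xs) = +-mono-≤ (𝟙≤1 (p x)) (tally-≤-length p xs)

  tally-split : ∀ (p q : A → Bool) xs → tally p xs ≡ tally (λ x → p x ∧ q x) xs + tally (λ x → p x ∧ not (q x)) xs
  tally-split p q [] = refl
  tally-split p q (x ∷ xs) with p x | q x
  ... | true | true = cong suc (tally-split p q xs)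
  ... | true | false = trans (cong suc (tally-split p q xs)) (sym (+-suc _ _))
  ... | false | _ = tally-split p q xs

  tally-pos⇒∃ : ∀ (p : A → Bool) xs → 1 ≤ tally p xs → ∃ λ x → p x ≡ true
  tally-pos⇒∃ p (x ∷ xs) h with p x in eq
  ... | true = x , eq
  ... | false = tally-pos⇒∃ p xs h

  tally-none : ∀ (p : A → Bool) xs → (∀ x → p x ≡ false) → tally p xs ≡ 0
  tally-none p [] h = refl
  tally-none p (x ∷ xs) h rewrite h x = tally-none p xs h

sum-mono-≤ : ∀ {n} {f g : Fin n → ℕ} → (∀ i → f i ≤ g i) → sum f ≤ sum g
sum-mono-≤ {zero} h = z≤n
sum-mono-≤ {suc n} h = +-mono-≤ (h zero) (sum-mono-≤ (h ∘ suc))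

term≤sum : ∀ {n} (f : Fin n → ℕ) i → f i ≤ sum f
term≤sum f zero = m≤m+n _ _
term≤sum f (suc i) = ≤-trans (term≤sum (f ∘ suc) i) (m≤n+m _ (f zero))

sum-zero : ∀ {n} {f : Fin n → ℕ} → (∀ i → f i ≡ 0) → sum f ≡ 0
sum-zero {zero} h = refl
sum-zero {suc n} h = cong₂ _+_ (h zero) (sum-zero (h ∘ suc))

sum-supported : ∀ {n} (f : Fin n → ℕ) x → (∀ i → i ≢ x → f i ≡ 0) → sum f ≡ f x
sum-supported f zero h = trans (cong (f zero +_) (sum-zero (λ i → h (suc i) λ ()))) (+-identityʳ _)
sum-supported f (suc x) h = trans (cong (_+ sum (f ∘ suc)) (h zero λ ()))
                                  (sum-supported (f ∘ suc) x (λ i i≢x → h (suc i) (i≢x ∘ FinP.suc-injective)))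

sum-pos⇒∃ : ∀ {n} (f : Fin n → ℕ) → 1 ≤ sum f → ∃ λ i → 1 ≤ f i
sum-pos⇒∃ {suc n} f h with f zero in e
... | suc _ = zero , subst (1 ≤_) (sym e) (s≤s z≤n)
... | zero = let (i , fi) = sum-pos⇒∃ (f ∘ suc) h in suc i , fi

sum-ones : ∀ n → sum {n} (λ _ → 1) ≡ n
sum-ones zero = refl
sum-ones (suc n) = cong suc (sum-ones n)

#_ : ∀ {n} → (Fin n → Bool) → ℕ
# q = sum (𝟙 ∘ q)

#-point : ∀ {n} (x : Fin n) → # (_==F x) ≡ 1
#-point x = trans (sum-supported _ x (λ i i≢x → cong 𝟙 (≢⇒==F-false i≢x))) (cong 𝟙 (==F-refl x))

#-compl : ∀ {n} (q : Fin n → Bool) → # q + # (not ∘ q) ≡ n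
#-compl {n} q = trans (sym (∑-distrib-+ (𝟙 ∘ q) (𝟙 ∘ not ∘ q)))
                      (trans (sum-cong-≗ (λ i → one (q i))) (sum-ones n))
  where
  one : ∀ b → 𝟙 b + 𝟙 (not b) ≡ 1
  one true = refl
  one false = refl

#-remove : ∀ {n} (q : Fin n → Bool) x → # q ≡ 𝟙 (q x) + # (λ i → q i ∧ not (i ==F x))
#-remove q x = begin
  # q                                                      ≡⟨ sum-cong-≗ (λ i → split (q i) (i ==F x)) ⟩
  sum (λ i → 𝟙 (q i ∧ (i ==F x)) + 𝟙 (q i ∧ not (i ==F x))) ≡⟨ ∑-distrib-+ (λ i → 𝟙 (q i ∧ (i ==F x))) (λ i → 𝟙 (q i ∧ not (i ==F x))) ⟩
  sum (λ i → 𝟙 (q i ∧ (i ==F x))) + # (λ i → q i ∧ not (i ==F x)) ≡⟨ cong (_+ # (λ i → q i ∧ not (i ==F x))) at-x ⟩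
  𝟙 (q x) + # (λ i → q i ∧ not (i ==F x)) ∎
  where
  open ≡-Reasoning
  split : ∀ a b → 𝟙 a ≡ 𝟙 (a ∧ b) + 𝟙 (a ∧ not b)
  split false b = refl
  split true true = refl
  split true false = refl
  at-x : sum (λ i → 𝟙 (q i ∧ (i ==F x))) ≡ 𝟙 (q x)
  at-x = trans (sum-supported _ x (λ i i≢x → trans (cong (λ b → 𝟙 (q i ∧ b)) (≢⇒==F-false i≢x))
                                                   (cong 𝟙 (BoolP.∧-zeroʳ (q i)))))
               (trans (cong (λ b → 𝟙 (q x ∧ b)) (==F-refl x)) (cong 𝟙 (BoolP.∧-identityʳ (q x))))

#-two-points : ∀ {n} {u w : Fin n} → u ≢ w → # (λ i → (i ==F u) ∨ (i ==F w)) ≡ 2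
#-two-points {u = u} {w} u≢w =
  trans (sum-cong-≗ split) (trans (∑-distrib-+ (𝟙 ∘ (_==F u)) (𝟙 ∘ (_==F w))) (cong₂ _+_ (#-point u) (#-point w)))
  where
  split : ∀ i → 𝟙 ((i ==F u) ∨ (i ==F w)) ≡ 𝟙 (i ==F u) + 𝟙 (i ==F w)
  split i with i Fin.≟ u | i Fin.≟ w
  ... | yes refl | yes refl = ⊥-elim (u≢w refl)
  ... | yes _ | no _ = refl
  ... | no _ | yes _ = refl
  ... | no _ | no _ = refl

#-avoiding : ∀ {n} (q : Fin n → Bool) (xs : List (Fin n)) → length xs < # q →
  ∃ λ z → q z ≡ true × All (z ≢_) xs
#-avoiding q [] h = let (z , qz) = sum-pos⇒∃ (𝟙 ∘ q) h in z , 𝟙-pos qz , []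
#-avoiding q (x ∷ xs) h =
  let (z , qz , z∉xs) = #-avoiding q′ xs (+-cancelˡ-≤ 1 _ _ (≤-trans h (≤-trans (≤-reflexive (#-remove q x))
                                                                             (+-monoˡ-≤ (# q′) (𝟙≤1 (q x))))))
  in z , ∧-true₁ {q z} qz , (λ z≡x → true≢false (∧-true₂ {q z} qz) (cong not (trans (cong (_==F x) z≡x) (==F-refl x)))) ∷ z∉xs
  where
  q′ : Fin _ → Bool
  q′ i = q i ∧ not (i ==F x)

length≤# : ∀ {n} (q : Fin n → Bool) {xs : List (Fin n)} → Unique xs → All (λ x → q x ≡ true) xs → length xs ≤ # q
length≤# q [] [] = z≤n
length≤# q {x ∷ xs} (x∉xs ∷ u) (qx ∷ qxs) = begin
  suc (length xs)                            ≤⟨ s≤s (length≤# (λ i → q i ∧ not (i ==F x)) u (All.zipWith keep (x∉xs , qxs))) ⟩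
  suc (# (λ i → q i ∧ not (i ==F x)))        ≡⟨ cong (λ b → 𝟙 b + # (λ i → q i ∧ not (i ==F x))) (sym qx) ⟩
  𝟙 (q x) + # (λ i → q i ∧ not (i ==F x))    ≡⟨ sym (#-remove q x) ⟩
  # q ∎
  where
  open ≤-Reasoning
  keep : ∀ {y} → x ≢ y × q y ≡ true → (q y ∧ not (y ==F x)) ≡ true
  keep (x≢y , qy) = ∧-intro qy (cong not (≢⇒==F-false (x≢y ∘ sym)))

sum-≤-holes : ∀ {n} (f : Fin n → ℕ) (hole : Fin n → Bool) → (∀ i → f i ≤ 1) → (∀ i → hole i ≡ true → f i ≡ 0) →
  sum f + # hole ≤ n
sum-≤-holes {n} f hole ≤1 at-hole = begin
  sum f + # hole               ≡⟨ sym (∑-distrib-+ f (𝟙 ∘ hole)) ⟩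
  sum (λ i → f i + 𝟙 (hole i)) ≤⟨ sum-mono-≤ pointwise ⟩
  sum {n} (λ _ → 1)            ≡⟨ sum-ones n ⟩
  n ∎
  where
  open ≤-Reasoning
  pointwise : ∀ i → f i + 𝟙 (hole i) ≤ 1
  pointwise i with hole i in h
  ... | false = ≤-trans (≤-reflexive (+-identityʳ (f i))) (≤1 i)
  ... | true = ≤-reflexive (cong (_+ 1) (at-hole i h))

sum-≤1 : ∀ {n} (f : Fin n → ℕ) → (∀ i → f i ≤ 1) → (∀ i j → 1 ≤ f i → 1 ≤ f j → i ≡ j) → sum f ≤ 1
sum-≤1 {zero} f _ _ = z≤n
sum-≤1 {suc n} f ≤1 unique with f zero in e
... | zero = sum-≤1 (f ∘ suc) (≤1 ∘ suc) (λ i j fi fj → FinP.suc-injective (unique (suc i) (suc j) fi fj))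
... | suc k = begin
  suc k + sum (f ∘ suc) ≡⟨ cong (suc k +_) (sum-zero rest) ⟩
  suc k + 0             ≡⟨ +-identityʳ (suc k) ⟩
  suc k                 ≤⟨ subst (_≤ 1) e (≤1 zero) ⟩
  1 ∎
  where
  open ≤-Reasoning
  rest : ∀ i → f (suc i) ≡ 0
  rest i with f (suc i) in ei
  ... | zero = refl
  ... | suc _ = case unique zero (suc i) (subst (1 ≤_) (sym e) (s≤s z≤n)) (subst (1 ≤_) (sym ei) (s≤s z≤n)) of λ ()

tally-by-value : ∀ {A : Set} {k} (p : A → Bool) (g : A → Fin k) xs →
  tally p xs ≡ sum (λ a → tally (λ x → p x ∧ (g x ==F a)) xs)
tally-by-value {k = k} p g [] = sym (sum-zero {k} (λ _ → refl))
tally-by-value p g (x ∷ xs) = begin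
  𝟙 (p x) + tally p xs
    ≡⟨ cong₂ _+_ (sym at-gx) (tally-by-value p g xs) ⟩
  sum (λ a → 𝟙 (p x ∧ (g x ==F a))) + sum (λ a → tally (λ y → p y ∧ (g y ==F a)) xs)
    ≡⟨ sym (∑-distrib-+ (λ a → 𝟙 (p x ∧ (g x ==F a))) (λ a → tally (λ y → p y ∧ (g y ==F a)) xs)) ⟩
  sum (λ a → tally (λ y → p y ∧ (g y ==F a)) (x ∷ xs)) ∎
  where
  open ≡-Reasoning
  at-gx : sum (λ a → 𝟙 (p x ∧ (g x ==F a))) ≡ 𝟙 (p x)
  at-gx = trans (sum-supported _ (g x) (λ a a≢gx → cong 𝟙 (trans (cong (p x ∧_) (≢⇒==F-false (a≢gx ∘ sym)))
                                                                   (BoolP.∧-zeroʳ (p x)))))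
                (cong 𝟙 (trans (cong (p x ∧_) (==F-refl (g x))) (BoolP.∧-identityʳ (p x))))

module _ {n : ℕ} (p : Fin n → Bool) where

  all-allFin⁻ : all p (allFin n) ≡ true → ∀ i → p i ≡ true
  all-allFin⁻ e i = to BoolP.T-≡ (AllP.tabulate⁻ (AllP.all⁺ p (allFin n) (from BoolP.T-≡ e)) i)

  all-allFin⁺ : (∀ i → p i ≡ true) → all p (allFin n) ≡ true
  all-allFin⁺ h = to BoolP.T-≡ (AllP.all⁻ p (AllP.tabulate⁺ (from BoolP.T-≡ ∘ h)))

  any-allFin⁻ : any p (allFin n) ≡ true → ∃ λ i → p i ≡ true
  any-allFin⁻ e = let (i , pi) = AnyP.tabulate⁻ (AnyP.any⁻ p (allFin n) (from BoolP.T-≡ e)) in i , to BoolP.T-≡ pi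

  any-allFin⁺ : ∀ i → p i ≡ true → any p (allFin n) ≡ true
  any-allFin⁺ i pi = to BoolP.T-≡ (AnyP.any⁺ p (AnyP.tabulate⁺ i (from BoolP.T-≡ pi)))

  all-allFin-false⁻ : all p (allFin n) ≡ false → ∃ λ i → p i ≡ false
  all-allFin-false⁻ e = let (i , ¬pi) = FinP.¬∀⟶∃¬ n (λ i → p i ≡ true) (λ i → p i Bool.≟ true)
                                                   (λ h → true≢false (all-allFin⁺ h) e)
                        in i , ¬true⇒false ¬pi

-- Colourings and stable partitions

infixr 5 _◂_
_◂_ : ∀ {n} → Fin 3 → Col n → Col (suc n)
(a ◂ c) zero = a
(a ◂ c) (suc i) = c i

◂-cong : ∀ {n} a {c c′ : Col n} → c ≗ c′ → (a ◂ c) ≗ (a ◂ c′)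
◂-cong a e zero = refl
◂-cong a e (suc i) = e i

Extensional : ∀ {n} → (Col n → Bool) → Set
Extensional {n} p = ∀ {c c′ : Col n} → c ≗ c′ → p c ≡ p c′

Extensional-∧ : ∀ {n} {p q : Col n → Bool} → Extensional p → Extensional q → Extensional (λ c → p c ∧ q c)
Extensional-∧ ext-p ext-q e = cong₂ _∧_ (ext-p e) (ext-q e)

Extensional-not : ∀ {n} {p : Col n → Bool} → Extensional p → Extensional (λ c → not (p c))
Extensional-not ext-p e = cong not (ext-p e)

Extensional-◂ : ∀ {n} {p : Col (suc n) → Bool} a → Extensional p → Extensional (λ c → p (a ◂ c))
Extensional-◂ a ext e = ext (◂-cong a e)

#Col : ∀ n → (Col n → Bool) → ℕ
#Col n p = tally p (allCols n)

-- Defs builds allCols (suc n) from one block per colour of vertex 0, with its own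
-- pattern-matching lambda in place of _◂_; the two agree only pointwise.
#Col-suc : ∀ {n} (p : Col (suc n) → Bool) → Extensional p → #Col (suc n) p ≡ sum (λ a → #Col n (λ c → p (a ◂ c)))
#Col-suc {n} p ext =
  trans (tally-++ p (map _ xs) _) (cong₂ _+_ (block 0F _ (λ c → λ { zero → refl ; (suc i) → refl }))
  (trans (tally-++ p (map _ xs) _) (cong₂ _+_ (block 1F _ (λ c → λ { zero → refl ; (suc i) → refl }))
  (trans (tally-++ p (map _ xs) []) (cong (_+ 0) (block 2F _ (λ c → λ { zero → refl ; (suc i) → refl })))))))
  where
  xs : List (Col n)
  xs = allCols n
  block : ∀ a (g : Col n → Col (suc n)) → (∀ c → g c ≗ (a ◂ c)) → tally p (map g xs) ≡ #Col n (λ c → p (a ◂ c))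
  block a g g≗ = trans (tally-map p g xs) (tally-cong xs (λ c → ext (g≗ c)))

module _ (n : ℕ) where

  #Col-cong : ∀ {p q : Col n → Bool} → (∀ c → p c ≡ q c) → #Col n p ≡ #Col n q
  #Col-cong = tally-cong (allCols n)

  #Col-mono : ∀ {p q : Col n → Bool} → (∀ c → p c ≡ true → q c ≡ true) → #Col n p ≤ #Col n q
  #Col-mono = tally-mono (allCols n)

  #Col-split : ∀ (p q : Col n → Bool) → #Col n p ≡ #Col n (λ c → p c ∧ q c) + #Col n (λ c → p c ∧ not (q c))
  #Col-split p q = tally-split p q (allCols n)

  #Col-none : ∀ (p : Col n → Bool) → (∀ c → p c ≡ false) → #Col n p ≡ 0
  #Col-none p = tally-none p (allCols n)

#Col-≤1 : ∀ n (p : Col n → Bool) → Extensional p → (∀ c c′ → p c ≡ true → p c′ ≡ true → c ≗ c′) → #Col n p ≤ 1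
#Col-≤1 zero p ext unique = +-mono-≤ (𝟙≤1 (p (λ ()))) z≤n
#Col-≤1 (suc n) p ext unique rewrite #Col-suc p ext = sum-≤1 _ (λ a → IH a) first-colour
  where
  IH : ∀ a → #Col n (λ c → p (a ◂ c)) ≤ 1
  IH a = #Col-≤1 n (λ c → p (a ◂ c)) (Extensional-◂ a ext) (λ c c′ pc pc′ i → unique _ _ pc pc′ (suc i))
  first-colour : ∀ a b → 1 ≤ #Col n (λ c → p (a ◂ c)) → 1 ≤ #Col n (λ c → p (b ◂ c)) → a ≡ b
  first-colour a b pa pb =
    let (c , pc) = tally-pos⇒∃ _ (allCols n) pa
        (c′ , pc′) = tally-pos⇒∃ _ (allCols n) pb
    in unique _ _ pc pc′ zero

#Col-pos : ∀ n (p : Col n → Bool) → Extensional p → (c : Col n) → p c ≡ true → 1 ≤ #Col n p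
#Col-pos zero p ext c pc = ≤-trans (≤-reflexive (cong 𝟙 (sym (trans (ext (λ ())) pc)))) (m≤m+n _ _)
#Col-pos (suc n) p ext c pc rewrite #Col-suc p ext =
  ≤-trans (#Col-pos n (λ c′ → p (c zero ◂ c′)) (Extensional-◂ (c zero) ext) (c ∘ suc)
                    (trans (ext (λ { zero → refl ; (suc i) → refl })) pc))
          (term≤sum (λ a → #Col n (λ c′ → p (a ◂ c′))) (c zero))

_≗ᵇ_ : ∀ {n} → Col n → Col n → Bool
_≗ᵇ_ {n} c c′ = all (λ i → c i ==F c′ i) (allFin n)

≗ᵇ⇒≗ : ∀ {n} {c c′ : Col n} → (c ≗ᵇ c′) ≡ true → c ≗ c′
≗ᵇ⇒≗ e i = ==F⇒≡ (all-allFin⁻ _ e i)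

≗⇒≗ᵇ : ∀ {n} {c c′ : Col n} → c ≗ c′ → (c ≗ᵇ c′) ≡ true
≗⇒≗ᵇ {c = c} {c′} e = all-allFin⁺ _ (λ i → trans (cong (c i ==F_) (sym (e i))) (==F-refl (c i)))

Extensional-≗ᵇ : ∀ {n} (c′ : Col n) → Extensional (_≗ᵇ c′)
Extensional-≗ᵇ c′ {c₁} {c₂} e = bool-ext (λ h → ≗⇒≗ᵇ (λ i → trans (sym (e i)) (≗ᵇ⇒≗ {c = c₁} h i)))
                                         (λ h → ≗⇒≗ᵇ (λ i → trans (e i) (≗ᵇ⇒≗ {c = c₂} h i)))

#Col-≥ : ∀ n m (p : Col n → Bool) → Extensional p → (g : Fin m → Col n) → (∀ j → p (g j) ≡ true) →
  (∀ i j → g i ≗ g j → i ≡ j) → m ≤ #Col n p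
#Col-≥ n zero p ext g pg g-inj = z≤n
#Col-≥ n (suc m) p ext g pg g-inj rewrite #Col-split n p (_≗ᵇ g zero) =
  +-mono-≤ (#Col-pos n _ (Extensional-∧ ext (Extensional-≗ᵇ (g zero))) (g zero) (∧-intro (pg zero) (≗⇒≗ᵇ {c = g zero} (λ _ → refl))))
           (#Col-≥ n m _ (Extensional-∧ ext (Extensional-not (Extensional-≗ᵇ (g zero)))) (g ∘ suc)
              (λ j → ∧-intro (pg (suc j)) (cong not (¬true⇒false (λ e → case g-inj (suc j) zero (≗ᵇ⇒≗ {c = g (suc j)} e) of λ ()))))
              (λ i j e → FinP.suc-injective (g-inj (suc i) (suc j) e)))

recolour : ∀ {n} → Permutation 3 3 → Col n → Col n
recolour π c = (π ⟨$⟩ʳ_) ∘ c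

recolour-◂ : ∀ {n} π a (c : Col n) → recolour π (a ◂ c) ≗ (π ⟨$⟩ʳ a) ◂ recolour π c
recolour-◂ π a c zero = refl
recolour-◂ π a c (suc i) = refl

#Col-recolour : ∀ (π : Permutation 3 3) n (p : Col n → Bool) → Extensional p → #Col n (p ∘ recolour π) ≡ #Col n p
#Col-recolour π zero p ext = cong (λ b → 𝟙 b + 0) (ext (λ ()))
#Col-recolour π (suc n) p ext = begin
  #Col (suc n) (p ∘ recolour π)                         ≡⟨ #Col-suc (p ∘ recolour π) (λ e → ext (cong (π ⟨$⟩ʳ_) ∘ e)) ⟩
  sum (λ a → #Col n (λ c → p (recolour π (a ◂ c))))     ≡⟨ sum-cong-≗ (λ a → #Col-cong n (λ c → ext (recolour-◂ π a c))) ⟩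
  sum (λ a → #Col n (λ c → p ((π ⟨$⟩ʳ a) ◂ recolour π c))) ≡⟨ sum-cong-≗ (λ a → #Col-recolour π n _ (Extensional-◂ (π ⟨$⟩ʳ a) ext)) ⟩
  sum (λ a → #Col n (λ c → p ((π ⟨$⟩ʳ a) ◂ c)))         ≡⟨ sym (∑-permute (λ b → #Col n (λ c → p (b ◂ c))) π) ⟩
  sum (λ b → #Col n (λ c → p (b ◂ c)))                  ≡⟨ sym (#Col-suc p ext) ⟩
  #Col (suc n) p ∎
  where open ≡-Reasoning

insertAt-cong : ∀ {m} (ℓ : Fin (suc m)) a {c c′ : Col m} → c ≗ c′ → insertAt c ℓ a ≗ insertAt c′ ℓ a
insertAt-cong zero a e zero = refl
insertAt-cong zero a e (suc i) = e i
insertAt-cong {suc m} (suc ℓ) a e zero = e zero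
insertAt-cong {suc m} (suc ℓ) a e (suc i) = insertAt-cong ℓ a (e ∘ suc) i

insertAt-zero : ∀ {m} (c : Col m) a → insertAt c zero a ≗ a ◂ c
insertAt-zero c a zero = refl
insertAt-zero c a (suc i) = refl

insertAt-◂ : ∀ {m} (ℓ : Fin (suc m)) b (c : Col m) a → insertAt (b ◂ c) (suc ℓ) a ≗ b ◂ insertAt c ℓ a
insertAt-◂ ℓ b c a zero = refl
insertAt-◂ ℓ b c a (suc i) = refl

#Col-insertAt : ∀ m (ℓ : Fin (suc m)) (p : Col (suc m) → Bool) → Extensional p →
  #Col (suc m) p ≡ sum (λ a → #Col m (λ c → p (insertAt c ℓ a)))
#Col-insertAt m zero p ext = trans (#Col-suc p ext) (sum-cong-≗ (λ a → #Col-cong m (λ c → ext (sym ∘ insertAt-zero c a))))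
#Col-insertAt (suc m) (suc ℓ) p ext = begin
  #Col (suc (suc m)) p
    ≡⟨ #Col-suc p ext ⟩
  sum (λ b → #Col (suc m) (λ c → p (b ◂ c)))
    ≡⟨ sum-cong-≗ (λ b → #Col-insertAt m ℓ (λ c → p (b ◂ c)) (Extensional-◂ b ext)) ⟩
  sum (λ b → sum (λ a → #Col m (λ c → p (b ◂ insertAt c ℓ a))))
    ≡⟨ ∑-comm (λ b a → #Col m (λ c → p (b ◂ insertAt c ℓ a))) ⟩
  sum (λ a → sum (λ b → #Col m (λ c → p (b ◂ insertAt c ℓ a))))
    ≡⟨ sum-cong-≗ (λ a → sum-cong-≗ (λ b → #Col-cong m (λ c → ext (sym ∘ insertAt-◂ ℓ b c a)))) ⟩
  sum (λ a → sum (λ b → #Col m (λ c → p (insertAt (b ◂ c) (suc ℓ) a))))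
    ≡⟨ sum-cong-≗ (λ a → sym (#Col-suc (λ c → p (insertAt c (suc ℓ) a)) (λ e → ext (insertAt-cong (suc ℓ) a e)))) ⟩
  sum (λ a → #Col (suc m) (λ c → p (insertAt c (suc ℓ) a))) ∎
  where open ≡-Reasoning

Proper : ∀ {n} → Graph n → Col n → Set
Proper G c = ∀ u v → Adj G u v → c u ≢ c v

infix 4 _≋_ _≋_∖_

_≋_ : ∀ {n} → Col n → Col n → Set
P ≋ Q = ∀ x y → (P x ≡ P y) ⇔ (Q x ≡ Q y)

_≋_∖_ : ∀ {n} → Col n → Col n → Fin n → Set
P ≋ Q ∖ v = ∀ x y → x ≢ v → y ≢ v → (P x ≡ P y) ⇔ (Q x ≡ Q y)

BellAdj : ∀ {n} → Col n → Col n → Set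
BellAdj P Q = ¬ (P ≋ Q) × ∃ λ v → P ≋ Q ∖ v

==F-==B⇒⇔ : ∀ {k} {a b c d : Fin k} → ((a ==F b) ==B (c ==F d)) ≡ true → (a ≡ b) ⇔ (c ≡ d)
==F-==B⇒⇔ {a = a} {b} {c} {d} e with a Fin.≟ b | c Fin.≟ d
... | yes p | yes q = mk⇔ (λ _ → q) (λ _ → p)
... | no ¬p | no ¬q = mk⇔ (⊥-elim ∘ ¬p) (⊥-elim ∘ ¬q)

⇔⇒==F-==B : ∀ {k} {a b c d : Fin k} → (a ≡ b) ⇔ (c ≡ d) → ((a ==F b) ==B (c ==F d)) ≡ true
⇔⇒==F-==B {a = a} {b} {c} {d} h with a Fin.≟ b | c Fin.≟ d
... | yes p | yes q = refl
... | yes p | no ¬q = ⊥-elim (¬q (to h p))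
... | no ¬p | yes q = ⊥-elim (¬p (from h q))
... | no ¬p | no ¬q = refl

module _ {n : ℕ} (G : Graph n) (c : Col n) where

  properB⇒Proper : properB G c ≡ true → Proper G c
  properB⇒Proper e u v uv cu≡cv =
    case trans (sym (all-allFin⁻ _ (all-allFin⁻ _ e u) v))
               (cong₂ (λ a b → not (a ∧ b)) uv (dec-true (c u Fin.≟ c v) cu≡cv)) of λ ()

  Proper⇒properB : Proper G c → properB G c ≡ true
  Proper⇒properB pr = all-allFin⁺ _ (λ u → all-allFin⁺ _ (λ v → edge u v))
    where
    edge : ∀ u v → not (adj G u v ∧ (c u ==F c v)) ≡ true
    edge u v with adj G u v in uv
    ... | false = refl
    ... | true = cong not (≢⇒==F-false (pr u v uv))

module _ {n : ℕ} (P Q : Col n) where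

  samePartition⇒≋ : samePartition P Q ≡ true → P ≋ Q
  samePartition⇒≋ e x y = ==F-==B⇒⇔ (all-allFin⁻ _ (all-allFin⁻ _ e x) y)

  ≋⇒samePartition : P ≋ Q → samePartition P Q ≡ true
  ≋⇒samePartition h = all-allFin⁺ _ (λ x → all-allFin⁺ _ (λ y → ⇔⇒==F-==B (h x y)))

  ¬≋⇒∃ : ¬ (P ≋ Q) → ∃ λ x → ∃ λ y → ¬ ((P x ≡ P y) ⇔ (Q x ≡ Q y))
  ¬≋⇒∃ ¬≋ =
    let (x , ex) = all-allFin-false⁻ _ (¬true⇒false (¬≋ ∘ samePartition⇒≋))
        (y , ey) = all-allFin-false⁻ _ ex
    in x , y , λ h → true≢false (⇔⇒==F-==B h) ey

  sameMinus⇒≋∖ : ∀ v → sameMinus v P Q ≡ true → P ≋ Q ∖ v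
  sameMinus⇒≋∖ v e x y x≢v y≢v =
    ==F-==B⇒⇔ (trans (sym (cong₂ (λ a b → a ∨ b ∨ _) (≢⇒==F-false x≢v) (≢⇒==F-false y≢v)))
                     (all-allFin⁻ _ (all-allFin⁻ _ e x) y))

  ≋∖⇒sameMinus : ∀ v → P ≋ Q ∖ v → sameMinus v P Q ≡ true
  ≋∖⇒sameMinus v h = all-allFin⁺ _ (λ x → all-allFin⁺ _ (λ y → pair x y))
    where
    pair : ∀ x y → ((x ==F v) ∨ (y ==F v) ∨ ((P x ==F P y) ==B (Q x ==F Q y))) ≡ true
    pair x y with x Fin.≟ v | y Fin.≟ v
    ... | yes _ | _ = refl
    ... | no _ | yes _ = refl
    ... | no x≢v | no y≢v = ⇔⇒==F-==B (h x y x≢v y≢v)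

  bellAdj⇒BellAdj : bellAdj P Q ≡ true → BellAdj P Q
  bellAdj⇒BellAdj e =
    (λ P≋Q → true≢false (≋⇒samePartition P≋Q) (not-true⇒false (∧-true₁ e))) ,
    let (v , ev) = any-allFin⁻ _ (∧-true₂ {not (samePartition P Q)} e) in v , sameMinus⇒≋∖ v ev

  BellAdj⇒bellAdj : BellAdj P Q → bellAdj P Q ≡ true
  BellAdj⇒bellAdj (¬≋ , v , h) =
    ∧-intro (cong not (¬true⇒false (¬≋ ∘ samePartition⇒≋))) (any-allFin⁺ _ v (≋∖⇒sameMinus v h))

module _ {n : ℕ} where

  ≋-sym : {P Q : Col n} → P ≋ Q → Q ≋ P
  ≋-sym h x y = ⇔.sym (h x y)

  ≋-trans : {P Q R : Col n} → P ≋ Q → Q ≋ R → P ≋ R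
  ≋-trans h k x y = ⇔.trans (h x y) (k x y)

  ≗⇒≋ : {P Q : Col n} → P ≗ Q → P ≋ Q
  ≗⇒≋ e x y = mk⇔ (λ h → trans (sym (e x)) (trans h (e y))) (λ h → trans (e x) (trans h (sym (e y))))

  ≋⇒≋∖ : ∀ {v} {P Q : Col n} → P ≋ Q → P ≋ Q ∖ v
  ≋⇒≋∖ h x y _ _ = h x y

  ≋∖-trans : ∀ {v} {P Q R : Col n} → P ≋ Q ∖ v → Q ≋ R ∖ v → P ≋ R ∖ v
  ≋∖-trans h k x y x≢v y≢v = ⇔.trans (h x y x≢v y≢v) (k x y x≢v y≢v)

  Proper-resp-≋ : ∀ (G : Graph n) {P Q : Col n} → P ≋ Q → Proper G P → Proper G Q
  Proper-resp-≋ G h pr u v uv = pr u v uv ∘ from (h u v)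

  BellAdj-respʳ : {P Q R : Col n} → Q ≋ R → BellAdj P Q → BellAdj P R
  BellAdj-respʳ h (¬≋ , v , k) = (λ s → ¬≋ (≋-trans s (≋-sym h))) , v , ≋∖-trans k (≋⇒≋∖ h)

  BellAdj-respˡ : {P Q R : Col n} → P ≋ R → BellAdj P Q → BellAdj R Q
  BellAdj-respˡ h (¬≋ , v , k) = (λ s → ¬≋ (≋-trans h s)) , v , ≋∖-trans (≋⇒≋∖ (≋-sym h)) k

  properB-resp-≋ : ∀ (G : Graph n) {P Q : Col n} → P ≋ Q → properB G P ≡ properB G Q
  properB-resp-≋ G {P} {Q} h = bool-ext (λ e → Proper⇒properB G Q (Proper-resp-≋ G h (properB⇒Proper G P e)))
                                        (λ e → Proper⇒properB G P (Proper-resp-≋ G (≋-sym h) (properB⇒Proper G Q e)))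

  bellAdj-respʳ : ∀ (P : Col n) {Q R : Col n} → Q ≋ R → bellAdj P Q ≡ bellAdj P R
  bellAdj-respʳ P {Q} {R} h = bool-ext (λ e → BellAdj⇒bellAdj P R (BellAdj-respʳ h (bellAdj⇒BellAdj P Q e)))
                                       (λ e → BellAdj⇒bellAdj P Q (BellAdj-respʳ (≋-sym h) (bellAdj⇒BellAdj P R e)))

  bellAdj-respˡ : ∀ {P R : Col n} (Q : Col n) → P ≋ R → bellAdj P Q ≡ bellAdj R Q
  bellAdj-respˡ {P} {R} Q h = bool-ext (λ e → BellAdj⇒bellAdj R Q (BellAdj-respˡ h (bellAdj⇒BellAdj P Q e)))
                                       (λ e → BellAdj⇒bellAdj P Q (BellAdj-respˡ (≋-sym h) (bellAdj⇒BellAdj R Q e)))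

  sameMinus-respʳ : ∀ v (P : Col n) {Q R : Col n} → Q ≋ R → sameMinus v P Q ≡ sameMinus v P R
  sameMinus-respʳ v P {Q} {R} h = bool-ext (λ e → ≋∖⇒sameMinus P R v (≋∖-trans (sameMinus⇒≋∖ P Q v e) (≋⇒≋∖ h)))
                                           (λ e → ≋∖⇒sameMinus P Q v (≋∖-trans (sameMinus⇒≋∖ P R v e) (≋⇒≋∖ (≋-sym h))))

  Extensional-properB : ∀ (G : Graph n) → Extensional (properB G)
  Extensional-properB G = properB-resp-≋ G ∘ ≗⇒≋

  Extensional-bellAdj : ∀ (P : Col n) → Extensional (bellAdj P)
  Extensional-bellAdj P = bellAdj-respʳ P ∘ ≗⇒≋

  Extensional-sameMinus : ∀ v (P : Col n) → Extensional (sameMinus v P)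
  Extensional-sameMinus v P = sameMinus-respʳ v P ∘ ≗⇒≋

RestrictedGrowth : ∀ {n} → Col n → Set
RestrictedGrowth c = ∀ j → c j ≡ 2F → ∃ λ i → toℕ i < toℕ j × c i ≡ 1F

IsCanonical : ∀ {n} → Col (suc n) → Set
IsCanonical c = c zero ≡ 0F × RestrictedGrowth c

rgFrom-≥2 : ∀ m xs → 2 ≤ m → rgFrom m xs ≡ true
rgFrom-≥2 m [] _ = refl
rgFrom-≥2 m (a ∷ xs) 2≤m =
  ∧-intro (to BoolP.T-≡ (<⇒<ᵇ (s≤s (≤-trans (toℕ≤2 a) 2≤m)))) (rgFrom-≥2 _ xs (≤-trans 2≤m (m≤m⊔n m _)))
  where
  toℕ≤2 : ∀ (a : Fin 3) → toℕ a ≤ 2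
  toℕ≤2 a = ≤-pred (FinP.toℕ<n a)

rgFrom1⇒RestrictedGrowth : ∀ {n} (c : Col n) → rgFrom 1 (tabulate c) ≡ true → RestrictedGrowth c
rgFrom1⇒RestrictedGrowth {suc n} c e j cj with c zero in c₀
rgFrom1⇒RestrictedGrowth {suc n} c e zero cj | 0F = case trans (sym c₀) cj of λ ()
rgFrom1⇒RestrictedGrowth {suc n} c e (suc j) cj | 0F =
  let (i , i<j , ci) = rgFrom1⇒RestrictedGrowth (c ∘ suc) e j cj in suc i , s≤s i<j , ci
rgFrom1⇒RestrictedGrowth {suc n} c e zero cj | 1F = case trans (sym c₀) cj of λ ()
rgFrom1⇒RestrictedGrowth {suc n} c e (suc j) cj | 1F = zero , s≤s z≤n , c₀

RestrictedGrowth⇒rgFrom1 : ∀ {n} (c : Col n) → RestrictedGrowth c → rgFrom 1 (tabulate c) ≡ true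
RestrictedGrowth⇒rgFrom1 {zero} c h = refl
RestrictedGrowth⇒rgFrom1 {suc n} c h with c zero in c₀
... | 0F = RestrictedGrowth⇒rgFrom1 (c ∘ suc) (λ j cj → shift j (h (suc j) cj))
  where
  shift : ∀ j → (∃ λ i → toℕ i < suc (toℕ j) × c i ≡ 1F) → ∃ λ i → toℕ i < toℕ j × c (suc i) ≡ 1F
  shift j (zero , _ , ci) = case trans (sym c₀) ci of λ ()
  shift j (suc i , s≤s i<j , ci) = i , i<j , ci
... | 1F = rgFrom-≥2 2 (tabulate (c ∘ suc)) ≤-refl
... | 2F = let (i , i<0 , _) = h zero c₀ in ⊥-elim (n≮0 i<0)

canonical⇔IsCanonical : ∀ {n} (c : Col (suc n)) → (canonical c ≡ true) ⇔ IsCanonical c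
canonical⇔IsCanonical c rewrite ListP.map-tabulate suc c with c zero in c₀
... | 0F = mk⇔ (λ e → refl , rgFrom1⇒RestrictedGrowth c (trans (cong (λ a → rgFrom 1 (a ∷ rest)) c₀) e))
               (λ (_ , rg) → trans (cong (λ a → rgFrom 1 (a ∷ rest)) (sym c₀)) (RestrictedGrowth⇒rgFrom1 c rg))
  where rest = tabulate (c ∘ suc)
... | 1F = mk⇔ (λ ()) (λ ())
... | 2F = mk⇔ (λ ()) (λ ())

IsCanonical-resp-≗ : ∀ {n} {c c′ : Col (suc n)} → c ≗ c′ → IsCanonical c → IsCanonical c′
IsCanonical-resp-≗ e (c₀ , rg) =
  trans (sym (e zero)) c₀ , λ j cj → let (i , i<j , ci) = rg j (trans (e j) cj) in i , i<j , trans (sym (e i)) ci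

Extensional-canonical : ∀ {n} → Extensional (canonical {suc n})
Extensional-canonical {c = c} {c′} e =
  bool-ext (from (canonical⇔IsCanonical c′) ∘ IsCanonical-resp-≗ e ∘ to (canonical⇔IsCanonical c))
           (from (canonical⇔IsCanonical c) ∘ IsCanonical-resp-≗ (sym ∘ e) ∘ to (canonical⇔IsCanonical c′))

canonical-unique : ∀ {n} {P Q : Col (suc n)} → IsCanonical P → IsCanonical Q → P ≋ Q → P ≗ Q
canonical-unique {n} {P} {Q} (P₀ , rgP) (Q₀ , rgQ) P≋Q j = below (suc (toℕ j)) j ≤-refl
  where
  step : ∀ j → (∀ i → toℕ i < toℕ j → P i ≡ Q i) → P j ≡ Q j
  step j IH with P j in Pj | Q j in Qj
  ... | 0F | 0F = refl
  ... | 1F | 1F = refl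
  ... | 2F | 2F = refl
  ... | 0F | 1F = case trans (sym Qj) (trans (to (P≋Q j zero) (trans Pj (sym P₀))) Q₀) of λ ()
  ... | 0F | 2F = case trans (sym Qj) (trans (to (P≋Q j zero) (trans Pj (sym P₀))) Q₀) of λ ()
  ... | 1F | 0F = case trans (sym Pj) (trans (from (P≋Q j zero) (trans Qj (sym Q₀))) P₀) of λ ()
  ... | 2F | 0F = case trans (sym Pj) (trans (from (P≋Q j zero) (trans Qj (sym Q₀))) P₀) of λ ()
  ... | 1F | 2F = let (i , i<j , Qi) = rgQ j Qj in
    case trans (sym Qi) (trans (to (P≋Q i j) (trans (IH i i<j) (trans Qi (sym Pj)))) Qj) of λ ()
  ... | 2F | 1F = let (i , i<j , Pi) = rgP j Pj in
    case trans (sym Pi) (trans (from (P≋Q i j) (trans (sym (IH i i<j)) (trans Pi (sym Qj)))) Pj) of λ ()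
  below : ∀ k j → toℕ j < k → P j ≡ Q j
  below (suc k) j j<k = step j (λ i i<j → below k i (≤-trans i<j (≤-pred j<k)))

first-≢ : ∀ {n} (c : Col n) a → (∀ i → c i ≡ a) ⊎ (∃ λ f → c f ≢ a × ∀ i → toℕ i < toℕ f → c i ≡ a)
first-≢ {n} c a with all? (λ i → c i Fin.≟ a)
... | yes all≡ = inj₁ all≡
... | no ¬all≡ =
  let (f , cf≢a , below) = FinP.¬∀⟶∃¬-smallest n (λ i → c i ≡ a) (λ i → c i Fin.≟ a) ¬all≡
  in inj₂ (f , cf≢a , λ i i<f → subst (λ j → c j ≡ a) (inject-fromℕ< i<f) (below (Fin.fromℕ< i<f)))
  where
  inject-fromℕ< : ∀ {f i : Fin n} (i<f : toℕ i < toℕ f) → Fin.inject (Fin.fromℕ< i<f) ≡ i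
  inject-fromℕ< i<f = FinP.toℕ-injective (trans (FinP.toℕ-inject _) (FinP.toℕ-fromℕ< i<f))

module _ {n : ℕ} (c : Col (suc n)) (c₀ : c zero ≡ 0F) (f : Fin (suc n)) (below-f : ∀ i → toℕ i < toℕ f → c i ≡ 0F) where

  first-other-1⇒IsCanonical : c f ≡ 1F → IsCanonical c
  first-other-1⇒IsCanonical cf = c₀ , rg
    where
    rg : RestrictedGrowth c
    rg j cj with toℕ f <? toℕ j
    ... | yes f<j = f , f<j , cf
    ... | no f≮j with m≤n⇒m<n∨m≡n (≮⇒≥ f≮j)
    ...   | inj₁ j<f = case trans (sym cj) (below-f j j<f) of λ ()
    ...   | inj₂ j≡f = case trans (sym cj) (trans (cong c (FinP.toℕ-injective j≡f)) cf) of λ ()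

  first-other-2⇒¬IsCanonical : c f ≡ 2F → ¬ IsCanonical c
  first-other-2⇒¬IsCanonical cf (_ , rg) = let (i , i<f , ci) = rg f cf in case trans (sym ci) (below-f i i<f) of λ ()

  canonical-by-first-other : c f ≢ 0F → canonical c ≡ (c f ==F 1F)
  canonical-by-first-other cf≢0 with c f in cf
  ... | 0F = ⊥-elim (cf≢0 refl)
  ... | 1F = from (canonical⇔IsCanonical c) (first-other-1⇒IsCanonical cf)
  ... | 2F = ¬true⇒false (first-other-2⇒¬IsCanonical cf ∘ to (canonical⇔IsCanonical c))

relabel : Fin 3 → Fin 3 → Fin 3 → Fin 3
relabel a b x = if x ==F a then 0F else if x ==F b then 1F else 2F

relabel-injective : ∀ (a b : Fin 3) → a ≢ b → ∀ x y → relabel a b x ≡ relabel a b y → x ≡ y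
relabel-injective = toWitness {a? = all? λ a → all? λ b → ¬? (a Fin.≟ b) →-dec all? λ x → all? λ y →
  (relabel a b x Fin.≟ relabel a b y) →-dec (x Fin.≟ y)} tt

relabel-first : ∀ (a b : Fin 3) → relabel a b a ≡ 0F
relabel-first = toWitness {a? = all? λ a → all? λ b → relabel a b a Fin.≟ 0F} tt

relabel-second : ∀ (a b : Fin 3) → a ≢ b → relabel a b b ≡ 1F
relabel-second = toWitness {a? = all? λ a → all? λ b → ¬? (a Fin.≟ b) →-dec (relabel a b b Fin.≟ 1F)} tt

normalise : ∀ {n} → Col (suc n) → Col (suc n)
normalise c with first-≢ c (c zero)
... | inj₁ _ = λ _ → 0F
... | inj₂ (f , _ , _) = relabel (c zero) (c f) ∘ c

normalise-≋ : ∀ {n} (c : Col (suc n)) → c ≋ normalise c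
normalise-≋ c x y with first-≢ c (c zero)
... | inj₁ all≡ = mk⇔ (λ _ → refl) (λ _ → trans (all≡ x) (sym (all≡ y)))
... | inj₂ (f , cf≢c₀ , _) = mk⇔ (cong (relabel (c zero) (c f))) (relabel-injective _ _ (cf≢c₀ ∘ sym) (c x) (c y))

normalise-IsCanonical : ∀ {n} (c : Col (suc n)) → IsCanonical (normalise c)
normalise-IsCanonical c with first-≢ c (c zero)
... | inj₁ _ = refl , λ j ()
... | inj₂ (f , cf≢c₀ , below-f) =
  first-other-1⇒IsCanonical (relabel (c zero) (c f) ∘ c) (relabel-first (c zero) (c f)) f
    (λ i i<f → trans (cong (relabel (c zero) (c f)) (below-f i i<f)) (relabel-first (c zero) (c f)))
    (relabel-second _ _ (cf≢c₀ ∘ sym))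

swap₁₂ : Permutation 3 3
swap₁₂ = transpose 1F 2F

swap₁₂-==1F : ∀ x → x ≢ 0F → ((swap₁₂ ⟨$⟩ʳ x) ==F 1F) ≡ not (x ==F 1F)
swap₁₂-==1F 0F x≢0 = ⊥-elim (x≢0 refl)
swap₁₂-==1F 1F _ = refl
swap₁₂-==1F 2F _ = refl

swap₁₂-==0F : ∀ x → ((swap₁₂ ⟨$⟩ʳ x) ==F 0F) ≡ (x ==F 0F)
swap₁₂-==0F 0F = refl
swap₁₂-==0F 1F = refl
swap₁₂-==0F 2F = refl

swap₁₂-≢0F : ∀ x → x ≢ 0F → (swap₁₂ ⟨$⟩ʳ x) ≢ 0F
swap₁₂-≢0F 0F x≢0 = ⊥-elim (x≢0 refl)
swap₁₂-≢0F 1F _ ()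
swap₁₂-≢0F 2F _ ()

canonical-swap₁₂ : ∀ {n} (c : Col (suc n)) → c zero ≡ 0F → (∃ λ j → c j ≢ 0F) →
  canonical (recolour swap₁₂ c) ≡ not (canonical c)
canonical-swap₁₂ c c₀ (j , cj≢0) with first-≢ c 0F
... | inj₁ all0 = ⊥-elim (cj≢0 (all0 j))
... | inj₂ (f , cf≢0 , below-f) = begin
  canonical (recolour swap₁₂ c) ≡⟨ canonical-by-first-other (recolour swap₁₂ c) (cong (swap₁₂ ⟨$⟩ʳ_) c₀) f
                                     (λ i i<f → cong (swap₁₂ ⟨$⟩ʳ_) (below-f i i<f)) (swap₁₂-≢0F (c f) cf≢0) ⟩
  ((swap₁₂ ⟨$⟩ʳ c f) ==F 1F)    ≡⟨ swap₁₂-==1F (c f) cf≢0 ⟩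
  not (c f ==F 1F)              ≡⟨ cong not (sym (canonical-by-first-other c c₀ f below-f cf≢0)) ⟩
  not (canonical c) ∎
  where open ≡-Reasoning

-- Trees

module _ {n : ℕ} (G : Graph n) where

  Adj-sym : ∀ {x y} → Adj G x y → Adj G y x
  Adj-sym {x} {y} xy = trans (Graph.sym G y x) xy

  Adj⇒≢ : ∀ {x y} → Adj G x y → x ≢ y
  Adj⇒≢ {x} xy refl = true≢false xy (Graph.irrefl G x)

data Walk {n} (G : Graph n) : Fin n → Fin n → Set where
  [] : ∀ {x} → Walk G x x
  _∷_ : ∀ {x y z} → Adj G x y → Walk G y z → Walk G x z

module _ {n : ℕ} (G : Graph n) where

  path⇒Walk : ∀ k (p : Fin (suc k) → Fin n) → (∀ (i : Fin k) → Adj G (p (inject₁ i)) (p (suc i))) →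
    Walk G (p zero) (p (fromℕ k))
  path⇒Walk zero p _ = []
  path⇒Walk (suc k) p edges = edges zero ∷ path⇒Walk k (p ∘ suc) (edges ∘ suc)

  Walk⇒path : ∀ {x y} → Walk G x y → ∃ λ k → Σ (Fin (suc k) → Fin n) λ p →
    (p zero ≡ x) × (p (fromℕ k) ≡ y) × (∀ (i : Fin k) → Adj G (p (inject₁ i)) (p (suc i)))
  Walk⇒path {x} [] = 0 , (λ _ → x) , refl , refl , λ ()
  Walk⇒path {x} (xy ∷ w) with Walk⇒path w
  ... | k , p , p₀ , pₖ , edges =
    suc k , (λ { zero → x ; (suc i) → p i }) , refl , pₖ , λ { zero → subst (Adj G x) (sym p₀) xy ; (suc i) → edges i }

  Connected⇒Walk : Connected G → ∀ x y → Walk G x y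
  Connected⇒Walk conn x y with conn x y
  ... | k , p , p₀ , pₖ , edges = subst₂ (Walk G) p₀ pₖ (path⇒Walk k p edges)

  Walk-invariant : ∀ {A : Set} (f : Fin n → A) → (∀ x y → Adj G x y → f x ≡ f y) → ∀ {x y} → Walk G x y → f x ≡ f y
  Walk-invariant f inv [] = refl
  Walk-invariant f inv (xy ∷ w) = trans (inv _ _ xy) (Walk-invariant f inv w)

  Connected-invariant : ∀ {A : Set} → Connected G → (f : Fin n → A) → (∀ x y → Adj G x y → f x ≡ f y) → ∀ x y → f x ≡ f y
  Connected-invariant conn f inv x y = Walk-invariant f inv (Connected⇒Walk conn x y)

HasNeighbours : ∀ {n} → Graph n → Set
HasNeighbours G = ∀ v → ∃ λ u → Adj G v u

Connected⇒HasNeighbours : ∀ {m} (G : Graph (suc (suc m))) → Connected G → HasNeighbours G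
Connected⇒HasNeighbours G conn v = first-step (Connected⇒Walk G conn v (other v)) (other≢ v)
  where
  other : ∀ {m} → Fin (suc (suc m)) → Fin (suc (suc m))
  other zero = suc zero
  other (suc _) = zero
  other≢ : ∀ {m} (v : Fin (suc (suc m))) → v ≢ other v
  other≢ zero ()
  other≢ (suc v) ()
  first-step : ∀ {x y} → Walk G x y → x ≢ y → ∃ λ z → Adj G x z
  first-step [] x≢x = ⊥-elim (x≢x refl)
  first-step (xz ∷ _) _ = _ , xz

IsLeaf : ∀ {n} → Graph n → Fin n → Fin n → Set
IsLeaf G ℓ p = Adj G ℓ p × (∀ y → Adj G ℓ y → y ≡ p)

_⊖_ : ∀ {m} → Graph (suc m) → Fin (suc m) → Graph m
G ⊖ ℓ = record
  { adj = λ i j → adj G (punchIn ℓ i) (punchIn ℓ j)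
  ; sym = λ i j → Graph.sym G (punchIn ℓ i) (punchIn ℓ j)
  ; irrefl = λ i → Graph.irrefl G (punchIn ℓ i) }

module _ {m : ℕ} (G : Graph (suc m)) (ℓ p : Fin (suc m)) (leaf : IsLeaf G ℓ p) where

  Walk-⊖-leaf : ∀ {x y} → Walk G x y → ∀ x′ y′ → x ≡ punchIn ℓ x′ → y ≡ punchIn ℓ y′ → Walk (G ⊖ ℓ) x′ y′
  Walk-⊖-leaf [] x′ y′ x≡ y≡ = subst (Walk (G ⊖ ℓ) x′) (punchIn-injective ℓ x′ y′ (trans (sym x≡) y≡)) []
  Walk-⊖-leaf {x} (_∷_ {y = z} xz w) x′ y′ x≡ y≡ with z Fin.≟ ℓ
  ... | no z≢ℓ = subst₂ (Adj G) x≡ (sym (punchIn-punchOut ℓ≢z)) xz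
                 ∷ Walk-⊖-leaf w (punchOut ℓ≢z) y′ (sym (punchIn-punchOut ℓ≢z)) y≡
    where ℓ≢z = z≢ℓ ∘ sym
  ... | yes refl with w
  ...   | [] = ⊥-elim (punchInᵢ≢i ℓ y′ (sym y≡))
  ...   | ℓz′ ∷ w′ = Walk-⊖-leaf w′ x′ y′ (trans (proj₂ leaf _ ℓz′) (trans (sym (proj₂ leaf x (Adj-sym G xz))) x≡)) y≡

  Connected-⊖-leaf : Connected G → Connected (G ⊖ ℓ)
  Connected-⊖-leaf conn x′ y′ =
    Walk⇒path (G ⊖ ℓ) (Walk-⊖-leaf (Connected⇒Walk G conn (punchIn ℓ x′) (punchIn ℓ y′)) x′ y′ refl refl)

  IsTree-⊖-leaf : IsTree G → IsTree (G ⊖ ℓ)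
  IsTree-⊖-leaf (conn , acyclic) =
    Connected-⊖-leaf conn ,
    λ (k , c , c-inj , edges , closing) → acyclic (k , punchIn ℓ ∘ c , c-inj ∘ punchIn-injective ℓ _ _ , edges , closing)

lookup-injective : ∀ {A : Set} {xs : List A} → Unique xs → ∀ {i j} → List.lookup xs i ≡ List.lookup xs j → i ≡ j
lookup-injective (_ ∷ _) {zero} {zero} _ = refl
lookup-injective (x∉xs ∷ _) {zero} {suc j} e = ⊥-elim (All.lookup x∉xs (∈-lookup j) e)
lookup-injective (x∉xs ∷ _) {suc i} {zero} e = ⊥-elim (All.lookup x∉xs (∈-lookup i) (sym e))
lookup-injective (_ ∷ unique) {suc i} {suc j} e = cong suc (lookup-injective unique e)

module _ {n : ℕ} (G : Graph n) where

  triangle : ∀ {a b c} → Adj G a b → Adj G b c → Adj G c a → HasCycle G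
  triangle {a} {b} {c} ab bc ca =
    0 , List.lookup (a ∷ b ∷ c ∷ []) , lookup-injective unique , (λ { 0F → ab ; 1F → bc }) , ca
    where
    unique : Unique (a ∷ b ∷ c ∷ [])
    unique = (Adj⇒≢ G ab ∷ (Adj⇒≢ G ca ∘ sym) ∷ []) ∷ (Adj⇒≢ G bc ∷ []) ∷ [] ∷ []

  square : ∀ {a b c d} → a ≢ c → b ≢ d → Adj G a b → Adj G b c → Adj G c d → Adj G d a → HasCycle G
  square {a} {b} {c} {d} a≢c b≢d ab bc cd da =
    1 , List.lookup (a ∷ b ∷ c ∷ d ∷ []) , lookup-injective unique , (λ { 0F → ab ; 1F → bc ; 2F → cd }) , da
    where
    unique : Unique (a ∷ b ∷ c ∷ d ∷ [])
    unique = (Adj⇒≢ G ab ∷ a≢c ∷ (Adj⇒≢ G da ∘ sym) ∷ []) ∷ (Adj⇒≢ G bc ∷ b≢d ∷ []) ∷ (Adj⇒≢ G cd ∷ []) ∷ [] ∷ []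

-- A walk that never immediately turns back repeats a vertex, and a repeat containing
-- no shorter repeat closes a cycle.
module NonBacktracking {n : ℕ} (G : Graph n) (w : ℕ → Fin n)
  (w-adj : ∀ i → Adj G (w i) (w (suc i))) (w-nb : ∀ i → w (suc (suc i)) ≢ w i) where

  MinimalRepeat : ℕ → ℕ → Set
  MinimalRepeat a g = w a ≡ w (a + g) × (∀ {s t : Fin g} → w (a + toℕ s) ≡ w (a + toℕ t) → s ≡ t)

  HasMinimalRepeat : Set
  HasMinimalRepeat = ∃ λ a → ∃ λ g → 0 < g × MinimalRepeat a g

  inner-repeat : ∀ {a g} (s t : Fin g) → toℕ s < toℕ t → w (a + toℕ s) ≡ w (a + toℕ t) →
    toℕ t ∸ toℕ s < g × 0 < toℕ t ∸ toℕ s × w (a + toℕ s) ≡ w (a + toℕ s + (toℕ t ∸ toℕ s))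
  inner-repeat {a} s t s<t eq =
    ≤-<-trans (m∸n≤m (toℕ t) (toℕ s)) (FinP.toℕ<n t) ,
    m<n⇒0<n∸m s<t ,
    trans eq (cong w (trans (cong (a +_) (sym (m+[n∸m]≡n (<⇒≤ s<t)))) (sym (+-assoc a (toℕ s) _))))

  minimalRepeat : ∀ g a → 0 < g → w a ≡ w (a + g) → HasMinimalRepeat
  minimalRepeat = <-rec (λ g → ∀ a → 0 < g → w a ≡ w (a + g) → HasMinimalRepeat) shrink
    where
    shrink : ∀ g → (∀ {g′} → g′ < g → ∀ a → 0 < g′ → w a ≡ w (a + g′) → HasMinimalRepeat) →
      ∀ a → 0 < g → w a ≡ w (a + g) → HasMinimalRepeat
    shrink g IH a 0<g repeat with all? (λ s → all? λ t → (w (a + toℕ s) Fin.≟ w (a + toℕ t)) →-dec (s Fin.≟ t))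
    ... | yes inj = a , g , 0<g , repeat , λ {s} {t} → inj s t
    ... | no ¬inj with FinP.¬∀⟶∃¬ g _ (λ s → all? λ t → (w (a + toℕ s) Fin.≟ w (a + toℕ t)) →-dec (s Fin.≟ t)) ¬inj
    ... | s , ¬inj-s with FinP.¬∀⟶∃¬ g _ (λ t → (w (a + toℕ s) Fin.≟ w (a + toℕ t)) →-dec (s Fin.≟ t)) ¬inj-s
    ... | t , ¬inj-st with w (a + toℕ s) Fin.≟ w (a + toℕ t) | <-cmp (toℕ s) (toℕ t)
    ...   | no ¬eq | _ = ⊥-elim (¬inj-st (⊥-elim ∘ ¬eq))
    ...   | yes _ | tri≈ _ s≡t _ = ⊥-elim (¬inj-st (λ _ → FinP.toℕ-injective s≡t))
    ...   | yes eq | tri< s<t _ _ = let (gap<g , 0<gap , rep) = inner-repeat s t s<t eq in IH gap<g _ 0<gap rep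
    ...   | yes eq | tri> _ _ t<s = let (gap<g , 0<gap , rep) = inner-repeat t s t<s (sym eq) in IH gap<g _ 0<gap rep

  MinimalRepeat⇒HasCycle : ∀ a g → 0 < g → MinimalRepeat a g → HasCycle G
  MinimalRepeat⇒HasCycle a 1 _ (repeat , _) = ⊥-elim (Adj⇒≢ G (w-adj a) (trans repeat (cong w (+-comm a 1))))
  MinimalRepeat⇒HasCycle a 2 _ (repeat , _) = ⊥-elim (w-nb a (trans (cong w (+-comm 2 a)) (sym repeat)))
  MinimalRepeat⇒HasCycle a (suc (suc (suc k))) _ (repeat , inj) = k , c , inj , edges , closing
    where
    c : Fin (suc (suc (suc k))) → Fin n
    c t = w (a + toℕ t)
    edges : ∀ (t : Fin (suc (suc k))) → Adj G (c (inject₁ t)) (c (suc t))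
    edges t = subst₂ (Adj G) (cong (λ i → w (a + i)) (sym (FinP.toℕ-inject₁ t))) (cong w (sym (+-suc a (toℕ t))))
                     (w-adj (a + toℕ t))
    closing : Adj G (c (fromℕ (suc (suc k)))) (c zero)
    closing = subst₂ (Adj G) (cong (λ i → w (a + i)) (sym (FinP.toℕ-fromℕ (suc (suc k)))))
                     (trans (cong w (sym (+-suc a (suc (suc k))))) (trans (sym repeat) (cong w (sym (+-identityʳ a)))))
                     (w-adj (a + suc (suc k)))

  hasCycle : HasCycle G
  hasCycle =
    let (i , j , i<j , wi≡wj) = FinP.pigeonhole ≤-refl (λ (t : Fin (suc n)) → w (toℕ t))
        (a , g , 0<g , minimal) = minimalRepeat (toℕ j ∸ toℕ i) (toℕ i) (m<n⇒0<n∸m i<j)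
                                    (trans wi≡wj (cong w (sym (m+[n∸m]≡n (<⇒≤ i<j)))))
    in MinimalRepeat⇒HasCycle a g 0<g minimal

IsTree⇒leaf : ∀ {m} (G : Graph (suc (suc m))) → IsTree G → ∃ λ ℓ → ∃ λ p → IsLeaf G ℓ p
IsTree⇒leaf {m} G (conn , acyclic)
  with any? (λ ℓ → any? λ p → (adj G ℓ p Bool.≟ true) ×-dec all? (λ y → (adj G ℓ y Bool.≟ true) →-dec (y Fin.≟ p)))
... | yes leaf = leaf
... | no no-leaf = ⊥-elim (acyclic (NonBacktracking.hasCycle G (proj₁ ∘ walk) (proj₂ ∘ proj₂ ∘ walk) no-return))
  where
  V = Fin (suc (suc m))
  Edge = Σ V λ x → Σ V λ y → Adj G x y
  onward : ∀ x y → Adj G x y → Σ V λ z → Adj G y z × z ≢ x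
  onward x y xy with any? (λ z → (adj G y z Bool.≟ true) ×-dec ¬? (z Fin.≟ x))
  ... | yes z = z
  ... | no no-z = ⊥-elim (no-leaf (y , x , Adj-sym G xy , only-x))
    where
    only-x : ∀ z → Adj G y z → z ≡ x
    only-x z yz = decidable-stable (z Fin.≟ x) (λ z≢x → no-z (z , yz , z≢x))
  next : Edge → Edge
  next (x , y , xy) = y , proj₁ (onward x y xy) , proj₁ (proj₂ (onward x y xy))
  walk : ℕ → Edge
  walk zero = let (y , 0y) = Connected⇒HasNeighbours G conn zero in zero , y , 0y
  walk (suc i) = next (walk i)
  no-return : ∀ i → proj₁ (walk (suc (suc i))) ≢ proj₁ (walk i)
  no-return i = let (x , y , xy) = walk i in proj₂ (proj₂ (onward x y xy))

-- The number of stable 3-partitions of a tree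

tally-avoiding-value : ∀ {A : Set} (p : A → Bool) (g : A → Fin 3) xs →
  sum (λ a → tally (λ x → p x ∧ not (g x ==F a)) xs) ≡ 2 * tally p xs
tally-avoiding-value p g [] = refl
tally-avoiding-value p g (x ∷ xs) = begin
  sum (λ a → 𝟙 (p x ∧ not (g x ==F a)) + tally (λ y → p y ∧ not (g y ==F a)) xs)
    ≡⟨ ∑-distrib-+ (λ a → 𝟙 (p x ∧ not (g x ==F a))) (λ a → tally (λ y → p y ∧ not (g y ==F a)) xs) ⟩
  sum (λ a → 𝟙 (p x ∧ not (g x ==F a))) + sum (λ a → tally (λ y → p y ∧ not (g y ==F a)) xs)
    ≡⟨ cong₂ _+_ (two-others (p x) (g x)) (tally-avoiding-value p g xs) ⟩
  2 * 𝟙 (p x) + 2 * tally p xs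
    ≡⟨ sym (*-distribˡ-+ 2 (𝟙 (p x)) (tally p xs)) ⟩
  2 * (𝟙 (p x) + tally p xs) ∎
  where
  open ≡-Reasoning
  two-others : ∀ b (v : Fin 3) → sum (λ a → 𝟙 (b ∧ not (v ==F a))) ≡ 2 * 𝟙 b
  two-others false v = refl
  two-others true 0F = refl
  two-others true 1F = refl
  two-others true 2F = refl

module _ {m : ℕ} (T : Graph (suc m)) (ℓ p : Fin (suc m)) (leaf : IsLeaf T ℓ p) where

  private
    ℓ≢p : ℓ ≢ p
    ℓ≢p = Adj⇒≢ T (proj₁ leaf)
    p′ = punchOut ℓ≢p
    p≡ : p ≡ punchIn ℓ p′
    p≡ = sym (punchIn-punchOut ℓ≢p)
    insertAt-p : ∀ (c : Col m) a → insertAt c ℓ a p ≡ c p′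
    insertAt-p c a = trans (cong (insertAt c ℓ a) p≡) (insertAt-punchIn c ℓ a p′)

  Proper-insertAt-leaf⇒ : ∀ (c : Col m) a → Proper T (insertAt c ℓ a) → Proper (T ⊖ ℓ) c × c p′ ≢ a
  Proper-insertAt-leaf⇒ c a pr =
    (λ i j ij ci≡cj → pr _ _ ij (trans (insertAt-punchIn c ℓ a i) (trans ci≡cj (sym (insertAt-punchIn c ℓ a j))))) ,
    (λ cp′≡a → pr ℓ p (proj₁ leaf) (trans (insertAt-lookup c ℓ a)
                   (trans (sym cp′≡a) (sym (insertAt-p c a)))))

  Proper-insertAt-leaf⇐ : ∀ (c : Col m) a → Proper (T ⊖ ℓ) c → c p′ ≢ a → Proper T (insertAt c ℓ a)
  Proper-insertAt-leaf⇐ c a pr cp′≢a u v uv cu≡cv with ℓ Fin.≟ u | ℓ Fin.≟ v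
  ... | yes refl | _ = cp′≢a (trans (sym (insertAt-p c a)) (trans (cong (insertAt c ℓ a) (sym (proj₂ leaf v uv)))
                                                          (trans (sym cu≡cv) (insertAt-lookup c ℓ a))))
  ... | no _ | yes refl = cp′≢a (trans (sym (insertAt-p c a)) (trans (cong (insertAt c ℓ a) (sym (proj₂ leaf u (Adj-sym T uv))))
                                                               (trans cu≡cv (insertAt-lookup c ℓ a))))
  ... | no ℓ≢u | no ℓ≢v =
    pr (punchOut ℓ≢u) (punchOut ℓ≢v) (subst₂ (Adj T) (sym (punchIn-punchOut ℓ≢u)) (sym (punchIn-punchOut ℓ≢v)) uv)
       (trans (sym (insertAt-punchIn c ℓ a _))
       (trans (cong (insertAt c ℓ a) (punchIn-punchOut ℓ≢u))
       (trans cu≡cv (trans (cong (insertAt c ℓ a) (sym (punchIn-punchOut ℓ≢v))) (insertAt-punchIn c ℓ a _)))))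

  properB-insertAt-leaf : ∀ (c : Col m) a → properB T (insertAt c ℓ a) ≡ (properB (T ⊖ ℓ) c ∧ not (c p′ ==F a))
  properB-insertAt-leaf c a = bool-ext
    (λ e → let (pr , cp′≢a) = Proper-insertAt-leaf⇒ c a (properB⇒Proper T _ e)
           in ∧-intro (Proper⇒properB (T ⊖ ℓ) c pr) (cong not (≢⇒==F-false cp′≢a)))
    (λ e → Proper⇒properB T _ (Proper-insertAt-leaf⇐ c a (properB⇒Proper (T ⊖ ℓ) c (∧-true₁ e))
                                  (==F-false⇒≢ (not-true⇒false (∧-true₂ {properB (T ⊖ ℓ) c} e)))))

  #proper-insertAt-leaf : #Col (suc m) (properB T) ≡ 2 * #Col m (properB (T ⊖ ℓ))
  #proper-insertAt-leaf = begin
    #Col (suc m) (properB T)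
      ≡⟨ #Col-insertAt m ℓ (properB T) (Extensional-properB T) ⟩
    sum (λ a → #Col m (λ c → properB T (insertAt c ℓ a)))
      ≡⟨ sum-cong-≗ (λ a → #Col-cong m (λ c → properB-insertAt-leaf c a)) ⟩
    sum (λ a → #Col m (λ c → properB (T ⊖ ℓ) c ∧ not (c p′ ==F a)))
      ≡⟨ tally-avoiding-value (properB (T ⊖ ℓ)) (λ c → c p′) (allCols m) ⟩
    2 * #Col m (properB (T ⊖ ℓ)) ∎
    where open ≡-Reasoning

#proper-tree : ∀ m (T : Graph (suc m)) → IsTree T → #Col (suc m) (properB T) ≡ 3 * 2 ^ m
#proper-tree zero T _ = trans (#Col-suc (properB T) (Extensional-properB T))
                              (sum-cong-≗ {3} (λ a → cong (_+ 0) (cong 𝟙 (Proper⇒properB T (a ◂ λ ()) single-vertex))))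
  where
  single-vertex : ∀ {c} → Proper T c
  single-vertex {c} zero zero uv = ⊥-elim (Adj⇒≢ T uv refl)
#proper-tree (suc m) T tree with IsTree⇒leaf T tree
... | ℓ , p , leaf = begin
  #Col (suc (suc m)) (properB T)   ≡⟨ #proper-insertAt-leaf T ℓ p leaf ⟩
  2 * #Col (suc m) (properB (T ⊖ ℓ)) ≡⟨ cong (2 *_) (#proper-tree m (T ⊖ ℓ) (IsTree-⊖-leaf T ℓ p leaf tree)) ⟩
  2 * (3 * 2 ^ m)                  ≡⟨ *-comm-middle ⟩
  3 * 2 ^ suc m ∎
  where
  open ≡-Reasoning
  *-comm-middle : 2 * (3 * 2 ^ m) ≡ 3 * (2 * 2 ^ m)
  *-comm-middle = trans (sym (*-assoc 2 3 (2 ^ m))) (trans (cong (_* 2 ^ m) (*-comm 2 3)) (*-assoc 3 2 (2 ^ m)))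

stableᵇ : ∀ {n} → Graph n → Col n → Bool
stableᵇ G c = properB G c ∧ canonical c

recolour-≋ : ∀ {n} (π : Permutation 3 3) (c : Col n) → c ≋ recolour π c
recolour-≋ π c x y = mk⇔ (cong (π ⟨$⟩ʳ_)) (λ e → trans (sym (inverseˡ π)) (trans (cong (π ⟨$⟩ˡ_) e) (inverseˡ π)))

properB-recolour : ∀ {n} (G : Graph n) π (c : Col n) → properB G (recolour π c) ≡ properB G c
properB-recolour G π c = properB-resp-≋ G (≋-sym (recolour-≋ π c))

transpose-==F : ∀ (a x : Fin 3) → ((transpose 0F a ⟨$⟩ʳ x) ==F a) ≡ (x ==F 0F)
transpose-==F = toWitness {a? = all? λ a → all? λ x → ((transpose 0F a ⟨$⟩ʳ x) ==F a) Bool.≟ (x ==F 0F)} tt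

module _ {m : ℕ} (T : Graph (suc (suc m))) (tree : IsTree T) where

  private
    N : ℕ
    N = suc (suc m)
    Pr : Col N → Bool
    Pr = properB T

    startsWith : Fin 3 → Col N → Bool
    startsWith a c = Pr c ∧ (c zero ==F a)

    Extensional-startsWith : ∀ a → Extensional (startsWith a)
    Extensional-startsWith a = Extensional-∧ (Extensional-properB T) (λ e → cong (_==F a) (e zero))

    #startsWith-uniform : ∀ a → #Col N (startsWith a) ≡ #Col N (startsWith 0F)
    #startsWith-uniform a = begin
      #Col N (startsWith a)                            ≡⟨ sym (#Col-recolour π N (startsWith a) (Extensional-startsWith a)) ⟩
      #Col N (λ c → startsWith a (recolour π c))        ≡⟨ #Col-cong N pointwise ⟩
      #Col N (startsWith 0F) ∎
      where
      open ≡-Reasoning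
      π = transpose 0F a
      pointwise : ∀ c → startsWith a (recolour π c) ≡ startsWith 0F c
      pointwise c = cong₂ _∧_ (properB-recolour T π c) (transpose-==F a (c zero))

    #proper≡3*#startsWith0 : #Col N Pr ≡ 3 * #Col N (startsWith 0F)
    #proper≡3*#startsWith0 = begin
      #Col N Pr                                  ≡⟨ tally-by-value Pr (λ c → c zero) (allCols N) ⟩
      sum (λ a → #Col N (startsWith a))          ≡⟨ sum-cong-≗ #startsWith-uniform ⟩
      sum {3} (λ _ → #Col N (startsWith 0F))     ≡⟨⟩
      3 * #Col N (startsWith 0F) ∎
      where open ≡-Reasoning

    non-canonical-swap : ∀ c → startsWith 0F (recolour swap₁₂ c) ∧ canonical (recolour swap₁₂ c)
                              ≡ startsWith 0F c ∧ not (canonical c)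
    non-canonical-swap c = begin
      startsWith 0F c′ ∧ canonical c′       ≡⟨ cong (_∧ canonical c′) (cong₂ _∧_ (properB-recolour T swap₁₂ c) (swap₁₂-==0F (c zero))) ⟩
      startsWith 0F c ∧ canonical c′        ≡⟨ ∧-congˡ-under swapped-canonical ⟩
      startsWith 0F c ∧ not (canonical c) ∎
      where
      open ≡-Reasoning
      c′ = recolour swap₁₂ c
      swapped-canonical : startsWith 0F c ≡ true → canonical c′ ≡ not (canonical c)
      swapped-canonical e =
        let pr = properB⇒Proper T c (∧-true₁ e)
            c₀ = ==F⇒≡ (∧-true₂ {Pr c} e)
            (u , 0u) = Connected⇒HasNeighbours T (proj₁ tree) zero
        in canonical-swap₁₂ c c₀ (u , λ cu≡0 → pr zero u 0u (trans c₀ (sym cu≡0)))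

    -- On proper colourings with c 0 = 0, swapping colours 1 and 2 toggles canonicity:
    -- vertex 0 has a neighbour, so some vertex has a colour other than 0.
    #startsWith0≡2*#stable : #Col N (startsWith 0F) ≡ 2 * #Col N (stableᵇ T)
    #startsWith0≡2*#stable = begin
      #Col N (startsWith 0F)
        ≡⟨ #Col-split N (startsWith 0F) canonical ⟩
      #Col N (λ c → startsWith 0F c ∧ canonical c) + #Col N (λ c → startsWith 0F c ∧ not (canonical c))
        ≡⟨ cong (#Col N (λ c → startsWith 0F c ∧ canonical c) +_) (sym swapped) ⟩
      #Col N (λ c → startsWith 0F c ∧ canonical c) + #Col N (λ c → startsWith 0F c ∧ canonical c)
        ≡⟨ cong (λ k → k + k) (#Col-cong N canonical-starts-with-0) ⟩
      #Col N (stableᵇ T) + #Col N (stableᵇ T)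
        ≡⟨ cong (#Col N (stableᵇ T) +_) (sym (+-identityʳ _)) ⟩
      2 * #Col N (stableᵇ T) ∎
      where
      open ≡-Reasoning
      swapped : #Col N (λ c → startsWith 0F c ∧ canonical c) ≡ #Col N (λ c → startsWith 0F c ∧ not (canonical c))
      swapped = trans (sym (#Col-recolour swap₁₂ N _ (Extensional-∧ (Extensional-startsWith 0F) Extensional-canonical)))
                      (#Col-cong N non-canonical-swap)
      canonical-starts-with-0 : ∀ c → (startsWith 0F c ∧ canonical c) ≡ stableᵇ T c
      canonical-starts-with-0 c =
        trans (BoolP.∧-assoc (Pr c) (c zero ==F 0F) (canonical c))
              (cong (Pr c ∧_) (∧-absorbˡ-under λ can → cong (_==F 0F) (proj₁ (to (canonical⇔IsCanonical c) can))))

  #stable-tree : #Col N (stableᵇ T) ≡ 2 ^ m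
  #stable-tree = *-cancelˡ-≡ (#Col N (stableᵇ T)) (2 ^ m) 6 (begin
    6 * #Col N (stableᵇ T)        ≡⟨ *-assoc 3 2 (#Col N (stableᵇ T)) ⟩
    3 * (2 * #Col N (stableᵇ T))  ≡⟨ cong (3 *_) (sym #startsWith0≡2*#stable) ⟩
    3 * #Col N (startsWith 0F)    ≡⟨ sym #proper≡3*#startsWith0 ⟩
    #Col N Pr                     ≡⟨ #proper-tree (suc m) T tree ⟩
    3 * (2 * 2 ^ m)               ≡⟨ sym (*-assoc 3 2 (2 ^ m)) ⟩
    6 * 2 ^ m ∎)
    where open ≡-Reasoning

-- Degrees in B₃(G)

≡-sym-⇔ : ∀ {x y x′ y′ : Fin 3} → (x ≡ y) ⇔ (x′ ≡ y′) → (y ≡ x) ⇔ (y′ ≡ x′)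
≡-sym-⇔ h = mk⇔ (sym ∘ to h ∘ sym) (sym ∘ from h ∘ sym)

Move : ∀ {n} → Fin n → Col n → Col n → Set
Move v P Q = ¬ (P ≋ Q) × P ≋ Q ∖ v

third-block-unique : ∀ (a b c d : Fin 3) → a ≢ b → c ≢ a → c ≢ b → d ≢ a → d ≢ b → c ≡ d
third-block-unique = toWitness {a? = all? λ a → all? λ b → all? λ c → all? λ d →
  ¬? (a Fin.≟ b) →-dec ¬? (c Fin.≟ a) →-dec ¬? (c Fin.≟ b) →-dec ¬? (d Fin.≟ a) →-dec ¬? (d Fin.≟ b) →-dec (c Fin.≟ d)} tt

third-block : ∀ (a b c d : Fin 3) → a ≢ b → c ≢ a → c ≢ b → (c ≡ d) ⇔ (d ≢ a × d ≢ b)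
third-block a b c d a≢b c≢a c≢b =
  mk⇔ (λ { refl → c≢a , c≢b }) (λ (d≢a , d≢b) → third-block-unique a b c d a≢b c≢a c≢b d≢a d≢b)

module _ {n : ℕ} {v : Fin n} {P Q : Col n} where

  Move⇒witness : Move v P Q → ∃ λ z → z ≢ v × ¬ ((P v ≡ P z) ⇔ (Q v ≡ Q z))
  Move⇒witness (¬≋ , ≋∖v) with ¬≋⇒∃ P Q ¬≋
  ... | x , y , ¬⇔ with x Fin.≟ v | y Fin.≟ v
  ... | no x≢v | no y≢v = ⊥-elim (¬⇔ (≋∖v x y x≢v y≢v))
  ... | yes refl | yes refl = ⊥-elim (¬⇔ (mk⇔ (λ _ → refl) (λ _ → refl)))
  ... | yes refl | no y≢v = y , y≢v , ¬⇔
  ... | no x≢v | yes refl = x , x≢v , ¬⇔ ∘ ≡-sym-⇔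

  -- With three blocks only, a vertex avoiding the blocks of a and b has its block forced.
  stays-in-third-block : ∀ {a b} → P ≋ Q ∖ v → a ≢ v → b ≢ v → P a ≢ P b →
    P v ≢ P a → P v ≢ P b → Q v ≢ Q a → Q v ≢ Q b → ∀ z → z ≢ v → (P v ≡ P z) ⇔ (Q v ≡ Q z)
  stays-in-third-block {a} {b} ≋∖v a≢v b≢v Pa≢Pb Pv≢Pa Pv≢Pb Qv≢Qa Qv≢Qb z z≢v =
    ⇔.trans (third-block (P a) (P b) (P v) (P z) Pa≢Pb Pv≢Pa Pv≢Pb)
            (⇔.trans (mk⇔ (λ (za , zb) → ¬-resp za (≋∖v z a z≢v a≢v) , ¬-resp zb (≋∖v z b z≢v b≢v))
                          (λ (za , zb) → ¬-resp za (⇔.sym (≋∖v z a z≢v a≢v)) , ¬-resp zb (⇔.sym (≋∖v z b z≢v b≢v))))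
                     (⇔.sym (third-block (Q a) (Q b) (Q v) (Q z) (Pa≢Pb ∘ from (≋∖v a b a≢v b≢v)) Qv≢Qa Qv≢Qb)))
    where
    ¬-resp : ∀ {A B : Set} → ¬ A → A ⇔ B → ¬ B
    ¬-resp ¬a h = ¬a ∘ from h

module _ {n : ℕ} {v u : Fin n} {P : Col n} (u≢v : u ≢ v) (Pu≢Pv : P u ≢ P v) where

  Move-joins : ∀ {y} {Q Q′ : Col n} → y ≢ v → Q u ≢ Q v → Q′ u ≢ Q′ v →
    Move v P Q → Move v P Q′ → Q v ≡ Q y → Q′ v ≡ Q′ y
  Move-joins {y} {Q} {Q′} y≢v Qu≢Qv Q′u≢Q′v move move′ Qv≡Qy with Q′ v Fin.≟ Q′ y | P v Fin.≟ P y
  ... | yes eq | _ = eq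
  ... | no _ | yes Pv≡Py =
    let (z , z≢v , ¬⇔) = Move⇒witness move
        y~z = proj₂ move y z y≢v z≢v
    in ⊥-elim (¬⇔ (mk⇔ (λ Pv≡Pz → trans Qv≡Qy (to y~z (trans (sym Pv≡Py) Pv≡Pz)))
                      (λ Qv≡Qz → trans Pv≡Py (from y~z (trans (sym Qv≡Qy) Qv≡Qz)))))
  ... | no Q′v≢Q′y | no Pv≢Py =
    let (z , z≢v , ¬⇔) = Move⇒witness move′
        Pu≢Py = λ Pu≡Py → Qu≢Qv (trans (to (proj₂ move u y u≢v y≢v) Pu≡Py) (sym Qv≡Qy))
    in ⊥-elim (¬⇔ (stays-in-third-block (proj₂ move′) u≢v y≢v Pu≢Py (Pu≢Pv ∘ sym) Pv≢Py (Q′u≢Q′v ∘ sym) Q′v≢Q′y z z≢v))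

  -- Both moves put v into the one block of P − v that is neither u's block nor v's old one.
  Move-unique : ∀ {Q Q′ : Col n} → Q u ≢ Q v → Q′ u ≢ Q′ v → Move v P Q → Move v P Q′ → Q ≋ Q′
  Move-unique {Q} {Q′} Qu≢Qv Q′u≢Q′v move move′ x y with x Fin.≟ v | y Fin.≟ v
  ... | yes refl | yes refl = mk⇔ (λ _ → refl) (λ _ → refl)
  ... | no x≢v | no y≢v = ⇔.trans (⇔.sym (proj₂ move x y x≢v y≢v)) (proj₂ move′ x y x≢v y≢v)
  ... | yes refl | no y≢v = mk⇔ (Move-joins y≢v Qu≢Qv Q′u≢Q′v move move′) (Move-joins y≢v Q′u≢Q′v Qu≢Qv move′ move)
  ... | no x≢v | yes refl = mk⇔ (sym ∘ Move-joins x≢v Qu≢Qv Q′u≢Q′v move move′ ∘ sym)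
                                 (sym ∘ Move-joins x≢v Q′u≢Q′v Qu≢Qv move′ move ∘ sym)

tally-≤-∑ : ∀ {A : Set} {m} (p : A → Bool) (q : Fin m → A → Bool) xs →
  (∀ x → p x ≡ true → ∃ λ v → q v x ≡ true) → tally p xs ≤ sum (λ v → tally (λ x → p x ∧ q v x) xs)
tally-≤-∑ p q [] _ = z≤n
tally-≤-∑ {m = m} p q (x ∷ xs) covered = begin
  𝟙 (p x) + tally p xs
    ≤⟨ +-mono-≤ head (tally-≤-∑ p q xs covered) ⟩
  sum (λ v → 𝟙 (p x ∧ q v x)) + sum (λ v → tally (λ y → p y ∧ q v y) xs)
    ≡⟨ sym (∑-distrib-+ (λ v → 𝟙 (p x ∧ q v x)) (λ v → tally (λ y → p y ∧ q v y) xs)) ⟩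
  sum (λ v → tally (λ y → p y ∧ q v y) (x ∷ xs)) ∎
  where
  open ≤-Reasoning
  head : 𝟙 (p x) ≤ sum (λ v → 𝟙 (p x ∧ q v x))
  head with p x in px
  ... | false = z≤n
  ... | true = let (v , qv) = covered x px in
    ≤-trans (≤-reflexive (cong 𝟙 (sym qv))) (term≤sum (λ v → 𝟙 (true ∧ q v x)) v)

SeesTwoColours : ∀ {n} → Graph n → Col n → Fin n → Set
SeesTwoColours G P v = ∃ λ u₁ → ∃ λ u₂ → Adj G v u₁ × Adj G v u₂ × P u₁ ≢ P u₂

module Degrees {n : ℕ} (T : Graph (suc n)) where

  N : ℕ
  N = suc n

  neighbourᵇ : Col N → Col N → Bool
  neighbourᵇ P Q = stableᵇ T Q ∧ bellAdj P Q

  deg : Col N → ℕ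
  deg P = #Col N (neighbourᵇ P)

  bellDegree≡deg : ∀ P → bellDegree T P ≡ deg P
  bellDegree≡deg P = trans (length-filter≡tally (bellAdj P) (stablePartitions T)) (tally-filter (stableᵇ T) (bellAdj P) (allCols N))

  deg-resp-≋ : ∀ {P P′} → P ≋ P′ → deg P ≡ deg P′
  deg-resp-≋ P≋P′ = #Col-cong N (λ Q → cong (stableᵇ T Q ∧_) (bellAdj-respˡ Q P≋P′))

  Extensional-stableᵇ : Extensional (stableᵇ T)
  Extensional-stableᵇ = Extensional-∧ (Extensional-properB T) Extensional-canonical

  Extensional-neighbourᵇ : ∀ P → Extensional (neighbourᵇ P)
  Extensional-neighbourᵇ P = Extensional-∧ Extensional-stableᵇ (Extensional-bellAdj P)

  movesᵇ : Col N → Fin N → Col N → Bool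
  movesᵇ P v Q = neighbourᵇ P Q ∧ sameMinus v P Q

  Extensional-movesᵇ : ∀ P v → Extensional (movesᵇ P v)
  Extensional-movesᵇ P v = Extensional-∧ (Extensional-neighbourᵇ P) (Extensional-sameMinus v P)

  moves : Col N → Fin N → ℕ
  moves P v = #Col N (movesᵇ P v)

  movesᵇ⇒ : ∀ {P v Q} → movesᵇ P v Q ≡ true → Proper T Q × IsCanonical Q × Move v P Q
  movesᵇ⇒ {P} {v} {Q} e =
    properB⇒Proper T Q (∧-true₁ stable) ,
    to (canonical⇔IsCanonical Q) (∧-true₂ {properB T Q} stable) ,
    proj₁ (bellAdj⇒BellAdj P Q (∧-true₂ {stableᵇ T Q} neighbour)) ,
    sameMinus⇒≋∖ P Q v (∧-true₂ {neighbourᵇ P Q} e)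
    where
    neighbour = ∧-true₁ e
    stable = ∧-true₁ neighbour

  moves≤1 : ∀ {P} → Proper T P → ∀ {v u} → Adj T v u → moves P v ≤ 1
  moves≤1 {P} pr {v} {u} vu = #Col-≤1 N (movesᵇ P v) (Extensional-movesᵇ P v) unique
    where
    unique : ∀ Q Q′ → movesᵇ P v Q ≡ true → movesᵇ P v Q′ ≡ true → Q ≗ Q′
    unique Q Q′ e e′ =
      let (prQ , canQ , move) = movesᵇ⇒ e
          (prQ′ , canQ′ , move′) = movesᵇ⇒ e′
          edge = λ {R} → λ (prR : Proper T R) → prR v u vu ∘ sym
      in canonical-unique canQ canQ′ (Move-unique (Adj⇒≢ T vu ∘ sym) (edge pr) (edge prQ) (edge prQ′) move move′)

  moves≡0-seeing-two-colours : ∀ {P} → Proper T P → ∀ {v} → SeesTwoColours T P v → moves P v ≡ 0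
  moves≡0-seeing-two-colours {P} pr {v} (u₁ , u₂ , vu₁ , vu₂ , Pu₁≢Pu₂) = #Col-none N (movesᵇ P v) (λ Q → ¬true⇒false (impossible Q))
    where
    impossible : ∀ Q → ¬ (movesᵇ P v Q ≡ true)
    impossible Q e =
      let (prQ , _ , move) = movesᵇ⇒ {P} {v} {Q} e
          (z , z≢v , ¬⇔) = Move⇒witness move
      in ¬⇔ (stays-in-third-block (proj₂ move) (Adj⇒≢ T vu₁ ∘ sym) (Adj⇒≢ T vu₂ ∘ sym) Pu₁≢Pu₂
                                  (pr v u₁ vu₁) (pr v u₂ vu₂) (prQ v u₁ vu₁) (prQ v u₂ vu₂) z z≢v)

  moves≡0-universal : ∀ {P} → Proper T P → ∀ {v} → (∀ x → x ≢ v → Adj T v x) → moves P v ≡ 0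
  moves≡0-universal {P} pr {v} universal = #Col-none N (movesᵇ P v) (λ Q → ¬true⇒false (impossible Q))
    where
    impossible : ∀ Q → ¬ (movesᵇ P v Q ≡ true)
    impossible Q e =
      let (prQ , _ , move) = movesᵇ⇒ {P} {v} {Q} e
          (z , z≢v , ¬⇔) = Move⇒witness move
      in ¬⇔ (mk⇔ (⊥-elim ∘ pr v z (universal z z≢v)) (⊥-elim ∘ prQ v z (universal z z≢v)))

  -- Every neighbour of P moves some vertex outside hole, and a vertex with a
  -- neighbour can be moved in at most one way.
  deg-bound : ∀ {P} → Proper T P → HasNeighbours T → (hole : Fin N → Bool) →
    (∀ Q → neighbourᵇ P Q ≡ true → ∃ λ v → hole v ≡ false × sameMinus v P Q ≡ true) → deg P + # hole ≤ N
  deg-bound {P} pr nbrs hole witness = begin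
    deg P + # hole  ≤⟨ +-monoˡ-≤ (# hole) (tally-≤-∑ (neighbourᵇ P) q (allCols N) covered) ⟩
    sum t + # hole  ≤⟨ sum-≤-holes t hole t≤1 t-hole ⟩
    N ∎
    where
    open ≤-Reasoning
    q : Fin N → Col N → Bool
    q v Q = sameMinus v P Q ∧ not (hole v)
    t : Fin N → ℕ
    t v = #Col N (λ Q → neighbourᵇ P Q ∧ q v Q)
    covered : ∀ Q → neighbourᵇ P Q ≡ true → ∃ λ v → q v Q ≡ true
    covered Q e = let (v , not-hole , same) = witness Q e in v , ∧-intro same (cong not not-hole)
    t≤1 : ∀ v → t v ≤ 1
    t≤1 v = ≤-trans (#Col-mono N (λ Q e → ∧-intro (∧-true₁ {neighbourᵇ P Q} e) (∧-true₁ (∧-true₂ {neighbourᵇ P Q} e))))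
                    (moves≤1 pr (proj₂ (nbrs v)))
    t-hole : ∀ v → hole v ≡ true → t v ≡ 0
    t-hole v h = #Col-none N _ (λ Q → trans (cong (λ b → neighbourᵇ P Q ∧ (sameMinus v P Q ∧ not b)) h)
                                            (trans (cong (neighbourᵇ P Q ∧_) (BoolP.∧-zeroʳ _)) (BoolP.∧-zeroʳ _)))

  witness-avoiding-frozen : ∀ {P} (hole : Fin N → Bool) → (∀ v → hole v ≡ true → moves P v ≡ 0) →
    ∀ Q → neighbourᵇ P Q ≡ true → ∃ λ v → hole v ≡ false × sameMinus v P Q ≡ true
  witness-avoiding-frozen {P} hole frozen Q e =
    let (v , ≋∖v) = proj₂ (bellAdj⇒BellAdj P Q (∧-true₂ {stableᵇ T Q} e))
        same = ≋∖⇒sameMinus P Q v ≋∖v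
    in v , ¬true⇒false (λ h → case subst (1 ≤_) (frozen v h) (#Col-pos N (movesᵇ P v) (Extensional-movesᵇ P v) Q (∧-intro e same))
                                of λ ()) , same

  one-frozen : ∀ {P} → Proper T P → HasNeighbours T → ∀ {v} → moves P v ≡ 0 → 1 + deg P ≤ N
  one-frozen {P} pr nbrs {v} frozen = begin
    1 + deg P           ≡⟨ +-comm 1 (deg P) ⟩
    deg P + 1           ≡⟨ cong (deg P +_) (sym (#-point v)) ⟩
    deg P + # (_==F v)  ≤⟨ deg-bound {P} pr nbrs (_==F v) (witness-avoiding-frozen {P} (_==F v) at-v) ⟩
    N ∎
    where
    open ≤-Reasoning
    at-v : ∀ x → (x ==F v) ≡ true → moves P x ≡ 0
    at-v x x≡v = subst (λ y → moves P y ≡ 0) (sym (==F⇒≡ x≡v)) frozen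

  two-frozen : ∀ {P} → Proper T P → HasNeighbours T → ∀ {v₀ v₁} → v₀ ≢ v₁ → moves P v₀ ≡ 0 → moves P v₁ ≡ 0 → 2 + deg P ≤ N
  two-frozen {P} pr nbrs {v₀} {v₁} v₀≢v₁ frozen₀ frozen₁ = begin
    2 + deg P           ≡⟨ +-comm 2 (deg P) ⟩
    deg P + 2           ≡⟨ cong (deg P +_) (sym (#-two-points v₀≢v₁)) ⟩
    deg P + # hole      ≤⟨ deg-bound {P} pr nbrs hole (witness-avoiding-frozen {P} hole at-hole) ⟩
    N ∎
    where
    open ≤-Reasoning
    hole : Fin N → Bool
    hole x = (x ==F v₀) ∨ (x ==F v₁)
    at-hole : ∀ x → hole x ≡ true → moves P x ≡ 0
    at-hole x h with ∨-true⇒ (x ==F v₀) h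
    ... | inj₁ x≡v₀ = subst (λ y → moves P y ≡ 0) (sym (==F⇒≡ x≡v₀)) frozen₀
    ... | inj₂ x≡v₁ = subst (λ y → moves P y ≡ 0) (sym (==F⇒≡ x≡v₁)) frozen₁

  _[_≔_] : Col N → Fin N → Fin 3 → Col N
  P [ v ≔ a ] = updateAt P v (λ _ → a)

  module _ (P : Col N) (v : Fin N) (a : Fin 3) where

    ≔-at : (P [ v ≔ a ]) v ≡ a
    ≔-at = updateAt-updates v P

    ≔-off : ∀ x → x ≢ v → (P [ v ≔ a ]) x ≡ P x
    ≔-off x x≢v = updateAt-minimal x v P x≢v

    Proper-≔ : Proper T P → (∀ x → Adj T v x → P x ≢ a) → Proper T (P [ v ≔ a ])
    Proper-≔ pr legal x y xy e with x Fin.≟ v | y Fin.≟ v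
    ... | yes refl | yes refl = Adj⇒≢ T xy refl
    ... | yes refl | no y≢v = legal y xy (trans (sym (≔-off y y≢v)) (trans (sym e) ≔-at))
    ... | no x≢v | yes refl = legal x (Adj-sym T xy) (trans (sym (≔-off x x≢v)) (trans e ≔-at))
    ... | no x≢v | no y≢v = pr x y xy (trans (sym (≔-off x x≢v)) (trans e (≔-off y y≢v)))

    ≔-≋∖ : P ≋ P [ v ≔ a ] ∖ v
    ≔-≋∖ x y x≢v y≢v = mk⇔ (λ e → trans (≔-off x x≢v) (trans e (sym (≔-off y y≢v))))
                            (λ e → trans (sym (≔-off x x≢v)) (trans e (≔-off y y≢v)))

  ≔-separated : ∀ {P v a v′ a′ z} → a ≢ P v → v ≢ v′ → z ≢ v → z ≢ v′ → (P z ≡ P v ⊎ P z ≡ a) →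
    ¬ (P [ v ≔ a ] ≋ P [ v′ ≔ a′ ])
  ≔-separated {P} {v} {a} {v′} {a′} {z} a≢Pv v≢v′ z≢v z≢v′ (inj₁ Pz≡Pv) h =
    a≢Pv (trans (sym (≔-at P v a))
         (trans (from (h v z) (trans (≔-off P v′ a′ v v≢v′) (trans (sym Pz≡Pv) (sym (≔-off P v′ a′ z z≢v′)))))
                (trans (≔-off P v a z z≢v) Pz≡Pv)))
  ≔-separated {P} {v} {a} {v′} {a′} {z} a≢Pv v≢v′ z≢v z≢v′ (inj₂ Pz≡a) h =
    a≢Pv (sym (trans (sym (≔-off P v′ a′ v v≢v′))
              (trans (to (h v z) (trans (≔-at P v a) (trans (sym Pz≡a) (sym (≔-off P v a z z≢v)))))
                     (trans (≔-off P v′ a′ z z≢v′) Pz≡a))))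

  ≔-changes : ∀ {P v a z} → a ≢ P v → z ≢ v → (P z ≡ P v ⊎ P z ≡ a) → ¬ (P ≋ P [ v ≔ a ])
  ≔-changes {P} {v} {a} {z} a≢Pv z≢v (inj₁ Pz≡Pv) h =
    a≢Pv (trans (sym (≔-at P v a)) (trans (to (h v z) (sym Pz≡Pv)) (trans (≔-off P v a z z≢v) Pz≡Pv)))
  ≔-changes {P} {v} {a} {z} a≢Pv z≢v (inj₂ Pz≡a) h =
    a≢Pv (trans (sym Pz≡a) (sym (from (h v z) (trans (≔-at P v a) (trans (sym Pz≡a) (sym (≔-off P v a z z≢v)))))))

  module LowerBound {P : Col N} (pr : Proper T P) {m : ℕ} (ι : Fin m → Fin N) (col : Fin m → Fin 3)
    (ι-injective : ∀ i j → ι i ≡ ι j → i ≡ j)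
    (changes : ∀ j → col j ≢ P (ι j))
    (legal : ∀ j x → Adj T (ι j) x → P x ≢ col j)
    (separated : ∀ i j → ∃ λ z → z ≢ ι i × z ≢ ι j × (P z ≡ P (ι i) ⊎ P z ≡ col i)) where

    moved : Fin m → Col N
    moved j = P [ ι j ≔ col j ]

    neighbour : ∀ j → neighbourᵇ P (normalise (moved j)) ≡ true
    neighbour j = ∧-intro
      (∧-intro (Proper⇒properB T _ (Proper-resp-≋ T (normalise-≋ (moved j)) (Proper-≔ P (ι j) (col j) pr (legal j))))
               (from (canonical⇔IsCanonical _) (normalise-IsCanonical (moved j))))
      (BellAdj⇒bellAdj P _ (BellAdj-respʳ (normalise-≋ (moved j))
        (let (z , z≢ι , _ , z-colour) = separated j j in ≔-changes (changes j) z≢ι z-colour , ι j , ≔-≋∖ P (ι j) (col j))))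

    distinct : ∀ i j → normalise (moved i) ≗ normalise (moved j) → i ≡ j
    distinct i j e with i Fin.≟ j
    ... | yes i≡j = i≡j
    ... | no i≢j =
      let (z , z≢ιi , z≢ιj , z-colour) = separated i j
      in ⊥-elim (≔-separated (changes i) (i≢j ∘ ι-injective i j) z≢ιi z≢ιj z-colour
                  (≋-trans (normalise-≋ (moved i)) (≋-trans (≗⇒≋ e) (≋-sym (normalise-≋ (moved j))))))

    m≤deg : m ≤ deg P
    m≤deg = #Col-≥ N m (neighbourᵇ P) (Extensional-neighbourᵇ P) (normalise ∘ moved) neighbour distinct

-- The bipartition and its classes

third : Fin 3 → Fin 3 → Fin 3
third 0F 1F = 2F
third 0F 2F = 1F
third 1F 0F = 2F
third 1F 2F = 0F
third 2F 0F = 1F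
third 2F 1F = 0F
third a _ = a

third-comm : ∀ (a b : Fin 3) → third a b ≡ third b a
third-comm = toWitness {a? = all? λ a → all? λ b → third a b Fin.≟ third b a} tt

third-≢ˡ : ∀ (a b : Fin 3) → a ≢ b → third a b ≢ a
third-≢ˡ = toWitness {a? = all? λ a → all? λ b → ¬? (a Fin.≟ b) →-dec ¬? (third a b Fin.≟ a)} tt

third-≢ʳ : ∀ (a b : Fin 3) → a ≢ b → third a b ≢ b
third-≢ʳ = toWitness {a? = all? λ a → all? λ b → ¬? (a Fin.≟ b) →-dec ¬? (third a b Fin.≟ b)} tt

third-cases : ∀ (a b d : Fin 3) → a ≢ b → d ≢ a → d ≡ b ⊎ d ≡ third a b
third-cases = toWitness {a? = all? λ a → all? λ b → all? λ d →
  ¬? (a Fin.≟ b) →-dec ¬? (d Fin.≟ a) →-dec ((d Fin.≟ b) ⊎-dec (d Fin.≟ third a b))} tt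

side : Bool → Fin 3
side true = 0F
side false = 1F

bipartition : ∀ {n} → (Fin (suc n) → Bool) → Col (suc n)
bipartition s x = side (s x ==B s zero)

module _ {n : ℕ} (s : Fin (suc n) → Bool) where

  bipartition-≡⇔ : ∀ x y → (bipartition s x ≡ bipartition s y) ⇔ (s x ≡ s y)
  bipartition-≡⇔ x y = mk⇔ (λ e → ==B-cancelʳ (s x) (s y) (s zero) (side-injective e))
                           (cong (λ b → side (b ==B s zero)))
    where
    side-injective : ∀ {a b} → side a ≡ side b → a ≡ b
    side-injective {true} {true} _ = refl
    side-injective {false} {false} _ = refl

  bipartition-Proper : ∀ (G : Graph (suc n)) → ProperSides G s → Proper G (bipartition s)
  bipartition-Proper G sides u v uv = sides u v uv ∘ to (bipartition-≡⇔ u v)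

  bipartition-≢2F : ∀ x → bipartition s x ≢ 2F
  bipartition-≢2F x with s x ==B s zero
  ... | true = λ ()
  ... | false = λ ()

  bipartition-IsCanonical : IsCanonical (bipartition s)
  bipartition-IsCanonical = cong side (==B-refl (s zero)) , λ j e → ⊥-elim (bipartition-≢2F j e)

two-colours-≡⇔ : ∀ (a b : Fin 3) → a ≢ 2F → b ≢ 2F → (a ≡ b) ⇔ ((a ==F 0F) ≡ (b ==F 0F))
two-colours-≡⇔ a b a≢2 b≢2 = mk⇔ (cong (_==F 0F)) (decided a b a≢2 b≢2)
  where
  decided : ∀ (a b : Fin 3) → a ≢ 2F → b ≢ 2F → (a ==F 0F) ≡ (b ==F 0F) → a ≡ b
  decided = toWitness {a? = all? λ a → all? λ b → ¬? (a Fin.≟ 2F) →-dec ¬? (b Fin.≟ 2F) →-dec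
    (((a ==F 0F) Bool.≟ (b ==F 0F)) →-dec (a Fin.≟ b))} tt

two-colours-flip : ∀ (a b : Fin 3) → a ≢ 2F → b ≢ 2F → a ≢ b → (a ==F 0F) ≡ not (b ==F 0F)
two-colours-flip = toWitness {a? = all? λ a → all? λ b → ¬? (a Fin.≟ 2F) →-dec ¬? (b Fin.≟ 2F) →-dec ¬? (a Fin.≟ b) →-dec
  ((a ==F 0F) Bool.≟ not (b ==F 0F))} tt

module _ {m : ℕ} (T : Graph (suc (suc m))) (s : Fin (suc (suc m)) → Bool) (conn : Connected T) (sides : ProperSides T s)
         {P : Col (suc (suc m))} (pr : Proper T P) (can : IsCanonical P) where

  private
    V : Set
    V = Fin (suc (suc m))

  -- The colour missing at v and its neighbours is invariant along edges, so P only uses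
  -- two colours and alternates along edges like s.
  sees-one-colour⇒≋bipartition : (∀ v → ¬ SeesTwoColours T P v) → P ≋ bipartition s
  sees-one-colour⇒≋bipartition one-colour x y =
    ⇔.trans (two-colours-≡⇔ (P x) (P y) (≢2F x) (≢2F y))
            (⇔.trans (==B-≡⇒⇔ _ _ _ _ (Connected-invariant T conn f f-invariant x y)) (⇔.sym (bipartition-≡⇔ s x y)))
    where
    nbr : V → V
    nbr v = proj₁ (Connected⇒HasNeighbours T conn v)
    v-nbr : ∀ v → Adj T v (nbr v)
    v-nbr v = proj₂ (Connected⇒HasNeighbours T conn v)
    colour-of-nbrs : ∀ v y → Adj T v y → P y ≡ P (nbr v)
    colour-of-nbrs v y vy = decidable-stable (P y Fin.≟ P (nbr v)) (λ ne → one-colour v (y , nbr v , vy , v-nbr v , ne))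
    missing : V → Fin 3
    missing v = third (P v) (P (nbr v))
    missing-invariant : ∀ x z → Adj T x z → missing x ≡ missing z
    missing-invariant x z xz = begin
      third (P x) (P (nbr x)) ≡⟨ cong (third (P x)) (sym (colour-of-nbrs x z xz)) ⟩
      third (P x) (P z)       ≡⟨ third-comm (P x) (P z) ⟩
      third (P z) (P x)       ≡⟨ cong (third (P z)) (colour-of-nbrs z x (Adj-sym T xz)) ⟩
      third (P z) (P (nbr z)) ∎
      where open ≡-Reasoning
    avoids-missing : ∀ x → P x ≢ missing zero
    avoids-missing x e = third-≢ˡ (P x) (P (nbr x)) (pr x _ (v-nbr x))
                           (trans (Connected-invariant T conn missing missing-invariant x zero) (sym e))
    ≢2F : ∀ x → P x ≢ 2F
    ≢2F x Px≡2 with missing zero in e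
    ... | 0F = avoids-missing zero (trans (proj₁ can) (sym e))
    ... | 1F = let (i , _ , Pi≡1) = proj₂ can x Px≡2 in avoids-missing i (trans Pi≡1 (sym e))
    ... | 2F = avoids-missing x (trans Px≡2 (sym e))
    f : V → Bool
    f x = (P x ==F 0F) ==B s x
    f-invariant : ∀ x z → Adj T x z → f x ≡ f z
    f-invariant x z xz =
      trans (cong₂ _==B_ (two-colours-flip (P x) (P z) (≢2F x) (≢2F z) (pr x z xz)) (BoolP.¬-not (sides x z xz)))
            (==B-not (P z ==F 0F) (s z))

  dichotomy : (∃ λ v → SeesTwoColours T P v) ⊎ P ≋ bipartition s
  dichotomy with any? (λ v → any? λ u₁ → any? λ u₂ →
                   (adj T v u₁ Bool.≟ true) ×-dec (adj T v u₂ Bool.≟ true) ×-dec ¬? (P u₁ Fin.≟ P u₂))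
  ... | yes sees = inj₁ sees
  ... | no none = inj₂ (sees-one-colour⇒≋bipartition (λ v sees → none (v , sees)))

tally-allFin : ∀ {n} (p : Fin n → Bool) → tally p (allFin n) ≡ # p
tally-allFin p = go p id
  where
  go : ∀ {n} {A : Set} (p : A → Bool) (g : Fin n → A) → tally p (tabulate g) ≡ sum (λ i → 𝟙 (p (g i)))
  go {zero} p g = refl
  go {suc n} p g = cong (𝟙 (p (g zero)) +_) (go p (g ∘ suc))

count≡# : ∀ {n} (p : Fin n → Bool) → count p ≡ # p
count≡# {n} p = trans (length-filter≡tally p (allFin n)) (tally-allFin p)

module Classes {m : ℕ} (T : Graph (suc (suc m))) (s : Fin (suc (suc m)) → Bool) (tree : IsTree T) (sides : ProperSides T s) where

  N : ℕ
  N = suc (suc m)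

  V : Set
  V = Fin N

  conn : Connected T
  conn = proj₁ tree

  class : Bool → V → Bool
  class b v = b ==B s v

  ∣_∣ : Bool → ℕ
  ∣ b ∣ = # (class b)

  smallClass≡ : smallClass s ≡ ∣ true ∣ ⊓ ∣ false ∣
  smallClass≡ = cong₂ _⊓_ (count≡# s) (count≡# (not ∘ s))

  smallClass≤ : ∀ b → smallClass s ≤ ∣ b ∣
  smallClass≤ true = ≤-trans (≤-reflexive smallClass≡) (m⊓n≤m _ _)
  smallClass≤ false = ≤-trans (≤-reflexive smallClass≡) (m⊓n≤n _ _)

  ≤smallClass : ∀ {k} → k ≤ ∣ true ∣ → k ≤ ∣ false ∣ → k ≤ smallClass s
  ≤smallClass k≤t k≤f = ≤-trans (⊓-glb k≤t k≤f) (≤-reflexive (sym smallClass≡))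

  smallClass-attained : ∃ λ b → ∣ b ∣ ≡ smallClass s
  smallClass-attained with ⊓-sel ∣ true ∣ ∣ false ∣
  ... | inj₁ e = true , trans (sym e) (sym smallClass≡)
  ... | inj₂ e = false , trans (sym e) (sym smallClass≡)

  ∣∣-compl : ∀ b → ∣ b ∣ + ∣ not b ∣ ≡ N
  ∣∣-compl b = trans (cong (∣ b ∣ +_) (sum-cong-≗ (λ v → cong 𝟙 (==B-not-distribˡ b (s v))))) (#-compl (class b))

  in-class : ∀ {b v} → s v ≡ b → class b v ≡ true
  in-class sv≡b = ≡⇒==B (sym sv≡b)

  class⇒ : ∀ {b v} → class b v ≡ true → s v ≡ b
  class⇒ e = sym (==B⇒≡ e)

  ∣∣≥1 : ∀ b → 1 ≤ ∣ b ∣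
  ∣∣≥1 b with s zero Bool.≟ b
  ... | yes s₀≡b = length≤# (class b) {zero ∷ []} ([] ∷ []) (in-class s₀≡b ∷ [])
  ... | no s₀≢b = let (u , 0u) = Connected⇒HasNeighbours T conn zero in
    length≤# (class b) {u ∷ []} ([] ∷ []) (in-class (≢-≢⇒≡ (sides u zero (Adj-sym T 0u)) (s₀≢b ∘ sym)) ∷ [])

  ∣∣≡1⇒unique : ∀ {b x y} → ∣ b ∣ ≡ 1 → s x ≡ b → s y ≡ b → x ≡ y
  ∣∣≡1⇒unique {b} {x} {y} size sx sy = decidable-stable (x Fin.≟ y) λ x≢y →
    <-irrefl refl (≤-trans (length≤# (class b) ((x≢y ∷ []) ∷ [] ∷ []) (in-class sx ∷ in-class sy ∷ [])) (≤-reflexive size))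

  ∣∣≡2⇒two : ∀ {b x y z} → ∣ b ∣ ≡ 2 → s x ≡ b → s y ≡ b → x ≢ y → s z ≡ b → z ≡ x ⊎ z ≡ y
  ∣∣≡2⇒two {b} {x} {y} {z} size sx sy x≢y sz with z Fin.≟ x | z Fin.≟ y
  ... | yes z≡x | _ = inj₁ z≡x
  ... | no _ | yes z≡y = inj₂ z≡y
  ... | no z≢x | no z≢y = ⊥-elim (<-irrefl refl (≤-trans
        (length≤# (class b) ((z≢x ∷ z≢y ∷ []) ∷ (x≢y ∷ []) ∷ [] ∷ []) (in-class sz ∷ in-class sx ∷ in-class sy ∷ []))
        (≤-reflexive size)))

  nbrs : HasNeighbours T
  nbrs = Connected⇒HasNeighbours T conn

  member : ∀ {b k} → suc k ≤ ∣ b ∣ → ∃ λ x → s x ≡ b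
  member {b} h = let (x , x∈ , _) = #-avoiding (class b) [] (≤-trans (s≤s z≤n) h) in x , class⇒ x∈

  smallClass≥1 : 1 ≤ smallClass s
  smallClass≥1 = ≤smallClass (∣∣≥1 true) (∣∣≥1 false)

  smallClass≡1⇒IsStar : smallClass s ≡ 1 → IsStar T
  smallClass≡1⇒IsStar k≡1 = c , centre
    where
    b = proj₁ smallClass-attained
    size : ∣ b ∣ ≡ 1
    size = trans (proj₂ smallClass-attained) k≡1
    c = proj₁ (member {b} (≤-reflexive (sym size)))
    sc : s c ≡ b
    sc = proj₂ (member {b} (≤-reflexive (sym size)))
    centre : ∀ v → v ≢ c → Adj T c v
    centre v v≢c =
      let (y , vy) = nbrs v
          sv≢b = λ sv≡b → v≢c (∣∣≡1⇒unique size sv≡b sc)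
          y≡c = ∣∣≡1⇒unique size (≢-≢⇒≡ (sides y v (Adj-sym T vy)) (sv≢b ∘ sym)) sc
      in Adj-sym T (subst (Adj T v) y≡c vy)

  IsStar⇒smallClass≡1 : IsStar T → smallClass s ≡ 1
  IsStar⇒smallClass≡1 (c , centre) = ≤-antisym (≤-trans (smallClass≤ (s c)) (≤-reflexive size)) smallClass≥1
    where
    only-c : ∀ v → class (s c) v ≡ (v ==F c)
    only-c v with v Fin.≟ c
    ... | yes refl = ==B-refl (s c)
    ... | no v≢c = ≢⇒==B-false (sides c v (centre v v≢c))
    size : ∣ s c ∣ ≡ 1
    size = trans (sum-cong-≗ (λ v → cong 𝟙 (only-c v))) (#-point c)

  module DoubleBroom (u mid w : V) (u≢w : u ≢ w) (u-mid : Adj T u mid) (mid-w : Adj T mid w)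
    (mid-nbrs : ∀ y → Adj T mid y → y ≡ u ⊎ y ≡ w)
    (leaves : ∀ x → x ≢ u → x ≢ mid → x ≢ w →
       (Adj T x u × (∀ y → Adj T x y → y ≡ u)) ⊎ (Adj T x w × (∀ y → Adj T x y → y ≡ w))) where

    sw≡su : s w ≡ s u
    sw≡su = ≢-≢⇒≡ (sides w mid (Adj-sym T mid-w)) (sides u mid u-mid)

    other-class : ∀ x → x ≢ u → x ≢ w → s x ≢ s u
    other-class x x≢u x≢w with x Fin.≟ mid
    ... | yes refl = sides mid u (Adj-sym T u-mid)
    ... | no x≢mid with leaves x x≢u x≢mid x≢w
    ...   | inj₁ (x-u , _) = sides x u x-u
    ...   | inj₂ (x-w , _) = λ sx≡su → sides x w x-w (trans sx≡su (sym sw≡su))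

    ∣su∣≡2 : ∣ s u ∣ ≡ 2
    ∣su∣≡2 = trans (sum-cong-≗ (λ v → cong 𝟙 (u-or-w v))) (#-two-points u≢w)
      where
      u-or-w : ∀ v → class (s u) v ≡ ((v ==F u) ∨ (v ==F w))
      u-or-w v with v Fin.≟ u | v Fin.≟ w
      ... | yes refl | _ = ==B-refl (s u)
      ... | no _ | yes refl = ≡⇒==B (sym sw≡su)
      ... | no v≢u | no v≢w = ≢⇒==B-false (other-class v v≢u v≢w ∘ sym)

    ∣not-su∣≡m : ∣ not (s u) ∣ ≡ m
    ∣not-su∣≡m = +-cancelˡ-≡ 2 _ _ (trans (cong (_+ ∣ not (s u) ∣) (sym ∣su∣≡2)) (∣∣-compl (s u)))

    smallClass≡2 : 2 ≤ m → smallClass s ≡ 2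
    smallClass≡2 2≤m = ≤-antisym (≤-trans (smallClass≤ (s u)) (≤-reflexive ∣su∣≡2)) (≤smallClass (both true) (both false))
      where
      both : ∀ b → 2 ≤ ∣ b ∣
      both b with s u Bool.≟ b
      ... | yes refl = ≤-reflexive (sym ∣su∣≡2)
      ... | no su≢b = subst (λ b′ → 2 ≤ ∣ b′ ∣) (trans (cong not (BoolP.¬-not su≢b)) (BoolP.not-involutive b))
                            (≤-trans 2≤m (≤-reflexive (sym ∣not-su∣≡m)))

  IsDoubleBroom⇒smallClass≡2 : 2 ≤ m → IsDoubleBroom T → smallClass s ≡ 2
  IsDoubleBroom⇒smallClass≡2 2≤m (u , mid , w , u≢w , u-mid , mid-w , mid-nbrs , leaves) =
    DoubleBroom.smallClass≡2 u mid w u≢w u-mid mid-w mid-nbrs leaves 2≤m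

  module TwoVertexClass {b : Bool} {u w : V} (size : ∣ b ∣ ≡ 2) (su : s u ≡ b) (sw : s w ≡ b) (u≢w : u ≢ w) where

    outside : ∀ {x} → x ≢ u → x ≢ w → s x ≢ b
    outside x≢u x≢w sx with ∣∣≡2⇒two size su sw u≢w sx
    ... | inj₁ x≡u = x≢u x≡u
    ... | inj₂ x≡w = x≢w x≡w

    nbr-of-outside : ∀ {x y} → s x ≢ b → Adj T x y → y ≡ u ⊎ y ≡ w
    nbr-of-outside {x} {y} sx≢b xy = ∣∣≡2⇒two size su sw u≢w (≢-≢⇒≡ (sides y x (Adj-sym T xy)) (sx≢b ∘ sym))

    -- Otherwise being u or adjacent to u would be invariant along edges.
    common-neighbour : ∃ λ mid → Adj T u mid × Adj T w mid
    common-neighbour with any? (λ z → (adj T u z Bool.≟ true) ×-dec (adj T w z Bool.≟ true))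
    ... | yes found = found
    ... | no none = ⊥-elim (true≢false (trans (sym (Connected-invariant T conn f f-invariant u w)) f-u) f-w)
      where
      f : V → Bool
      f x = (x ==F u) ∨ adj T x u
      f-u : f u ≡ true
      f-u = cong (_∨ adj T u u) (==F-refl u)
      w-u : adj T w u ≡ false
      w-u = ¬true⇒false (λ wu → sides w u wu (trans sw (sym su)))
      f-w : f w ≡ false
      f-w = cong₂ _∨_ (≢⇒==F-false (u≢w ∘ sym)) w-u
      far : ∀ x z → Adj T x z → x ≢ u → z ≢ u → adj T x u ≡ adj T z u
      far x z xz x≢u z≢u with x Fin.≟ w | z Fin.≟ w
      ... | yes refl | yes refl = ⊥-elim (Adj⇒≢ T xz refl)
      ... | yes refl | no _ = trans w-u (sym (¬true⇒false (λ zu → none (z , Adj-sym T zu , xz))))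
      ... | no _ | yes refl = trans (¬true⇒false (λ xu → none (x , Adj-sym T xu , Adj-sym T xz))) (sym w-u)
      ... | no x≢w | no z≢w = ⊥-elim (sides x z xz (≢-≢⇒≡ (outside x≢u x≢w) (outside z≢u z≢w)))
      f-invariant : ∀ x z → Adj T x z → f x ≡ f z
      f-invariant x z xz with x Fin.≟ u | z Fin.≟ u
      ... | yes x≡u | yes z≡u = ⊥-elim (Adj⇒≢ T xz (trans x≡u (sym z≡u)))
      ... | yes x≡u | no _ = sym (Adj-sym T (subst (λ q → Adj T q z) x≡u xz))
      ... | no _ | yes z≡u = subst (Adj T x) z≡u xz
      ... | no x≢u | no z≢u = far x z xz x≢u z≢u

    isDoubleBroom : IsDoubleBroom T
    isDoubleBroom = u , mid , w , u≢w , u-mid , Adj-sym T w-mid , (λ y → nbr-of-outside smid≢b) , leaves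
      where
      mid = proj₁ common-neighbour
      u-mid = proj₁ (proj₂ common-neighbour)
      w-mid = proj₂ (proj₂ common-neighbour)
      smid≢b : s mid ≢ b
      smid≢b smid≡b = sides u mid u-mid (trans su (sym smid≡b))
      no-square : ∀ {x} → x ≢ mid → Adj T x u → Adj T x w → ⊥
      no-square x≢mid xu xw = proj₂ tree (square T u≢w (x≢mid ∘ sym) u-mid (Adj-sym T w-mid) (Adj-sym T xw) xu)
      leaves : ∀ x → x ≢ u → x ≢ mid → x ≢ w →
        (Adj T x u × (∀ y → Adj T x y → y ≡ u)) ⊎ (Adj T x w × (∀ y → Adj T x y → y ≡ w))
      leaves x x≢u x≢mid x≢w with nbrs x
      ... | y , xy with nbr-of-outside (outside x≢u x≢w) xy
      ... | inj₁ refl = inj₁ (xy , λ y′ xy′ → [ id , (λ { refl → ⊥-elim (no-square x≢mid xy xy′) }) ]′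
                                                 (nbr-of-outside (outside x≢u x≢w) xy′))
      ... | inj₂ refl = inj₂ (xy , λ y′ xy′ → [ (λ { refl → ⊥-elim (no-square x≢mid xy′ xy) }) , id ]′
                                                 (nbr-of-outside (outside x≢u x≢w) xy′))

  smallClass≡2⇒IsDoubleBroom : smallClass s ≡ 2 → IsDoubleBroom T
  smallClass≡2⇒IsDoubleBroom k≡2 = from-class (proj₁ smallClass-attained) (trans (proj₂ smallClass-attained) k≡2)
    where
    from-class : ∀ b → ∣ b ∣ ≡ 2 → IsDoubleBroom T
    from-class b size = first (#-avoiding (class b) [] (≤-trans (s≤s z≤n) (≤-reflexive (sym size))))
      where
      second : ∀ {u} → class b u ≡ true → (∃ λ w → class b w ≡ true × All (w ≢_) (u ∷ [])) → IsDoubleBroom T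
      second {u} u∈ (w , w∈ , w≢u ∷ []) = TwoVertexClass.isDoubleBroom size (class⇒ {b} u∈) (class⇒ {b} w∈) (w≢u ∘ sym)
      first : (∃ λ u → class b u ≡ true × All (u ≢_) []) → IsDoubleBroom T
      first (u , u∈ , []) = second u∈ (#-avoiding (class b) (u ∷ []) (≤-reflexive (sym size)))

-- Degrees for stars, double brooms and trees with |X| ≥ 3

module StarProfile {m : ℕ} (T : Graph (suc (suc m))) (tree : IsTree T) (c : Fin (suc (suc m))) (centre : ∀ v → v ≢ c → Adj T c v) where

  open Degrees T

  leaf-nbr : ∀ {ℓ x} → ℓ ≢ c → Adj T ℓ x → x ≡ c
  leaf-nbr {ℓ} {x} ℓ≢c ℓx =
    decidable-stable (x Fin.≟ c) (λ x≢c → proj₂ tree (triangle T (centre ℓ ℓ≢c) ℓx (Adj-sym T (centre x x≢c))))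

  deg≡ : 2 ≤ m → ∀ {P} → Proper T P → deg P ≡ suc m
  deg≡ 2≤m {P} pr = ≤-antisym upper (LowerBound.m≤deg {P} pr (punchIn c) col (punchIn-injective c) changes legal separated)
    where
    nbrs : HasNeighbours T
    nbrs = Connected⇒HasNeighbours T (proj₁ tree)
    upper : deg P ≤ suc m
    upper = ≤-pred (one-frozen {P} pr nbrs {c} (moves≡0-universal {P} pr {c} centre))
    Pc≢ : ∀ j → P c ≢ P (punchIn c j)
    Pc≢ j = pr c (punchIn c j) (centre (punchIn c j) (punchInᵢ≢i c j))
    col : Fin (suc m) → Fin 3
    col j = third (P c) (P (punchIn c j))
    changes : ∀ j → col j ≢ P (punchIn c j)
    changes j = third-≢ʳ (P c) (P (punchIn c j)) (Pc≢ j)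
    legal : ∀ j x → Adj T (punchIn c j) x → P x ≢ col j
    legal j x jx Px≡col = third-≢ˡ (P c) (P (punchIn c j)) (Pc≢ j) (trans (sym Px≡col) (cong P (leaf-nbr (punchInᵢ≢i c j) jx)))
    separated : ∀ i j → ∃ λ z → z ≢ punchIn c i × z ≢ punchIn c j × (P z ≡ P (punchIn c i) ⊎ P z ≡ col i)
    four≤N : 4 ≤ # (λ (_ : Fin (suc (suc m))) → true)
    four≤N = ≤-trans (s≤s (s≤s 2≤m)) (≤-reflexive (sym (sum-ones (suc (suc m)))))
    separated i j = pick (#-avoiding (λ _ → true) (c ∷ punchIn c i ∷ punchIn c j ∷ []) four≤N)
      where
      pick : (∃ λ z → true ≡ true × All (z ≢_) (c ∷ punchIn c i ∷ punchIn c j ∷ [])) →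
        ∃ λ z → z ≢ punchIn c i × z ≢ punchIn c j × (P z ≡ P (punchIn c i) ⊎ P z ≡ col i)
      pick (z , _ , z≢c ∷ z≢i ∷ z≢j ∷ []) =
        z , z≢i , z≢j , third-cases (P c) (P (punchIn c i)) (P z) (Pc≢ i) (λ Pz≡Pc → pr c z (centre z z≢c) (sym Pz≡Pc))

module BigProfile {m : ℕ} (T : Graph (suc (suc m))) (s : Fin (suc (suc m)) → Bool) (tree : IsTree T) (sides : ProperSides T s)
  (big : 3 ≤ smallClass s) where

  open Degrees T
  open Classes T s tree sides using (class; smallClass≤; class⇒; nbrs; conn)

  P₀ : Col N
  P₀ = bipartition s

  deg-P₀ : N ≤ deg P₀
  deg-P₀ = LowerBound.m≤deg {P₀} (bipartition-Proper s T sides) id (λ _ → 2F) (λ i j e → e) changes legal separated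
    where
    changes : ∀ j → 2F ≢ P₀ j
    changes j = bipartition-≢2F s j ∘ sym
    legal : ∀ j x → Adj T j x → P₀ x ≢ 2F
    legal j x _ = bipartition-≢2F s x
    separated : ∀ i j → ∃ λ z → z ≢ i × z ≢ j × (P₀ z ≡ P₀ i ⊎ P₀ z ≡ 2F)
    separated i j = pick (#-avoiding (class (s i)) (i ∷ j ∷ []) (≤-trans big (smallClass≤ (s i))))
      where
      pick : (∃ λ z → class (s i) z ≡ true × All (z ≢_) (i ∷ j ∷ [])) → ∃ λ z → z ≢ i × z ≢ j × (P₀ z ≡ P₀ i ⊎ P₀ z ≡ 2F)
      pick (z , z∈ , z≢i ∷ z≢j ∷ []) = z , z≢i , z≢j , inj₁ (from (bipartition-≡⇔ s z i) (class⇒ {s i} z∈))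

  maximum-unique : ∀ {P} → Proper T P → IsCanonical P → N ≤ deg P → P ≗ P₀
  maximum-unique {P} pr can large = [ frozen , canonical-unique can (bipartition-IsCanonical s) ]′ (dichotomy T s conn sides pr can)
    where
    frozen : (∃ λ v → SeesTwoColours T P v) → P ≗ P₀
    frozen (v , sees) = ⊥-elim (<-irrefl refl (≤-trans (one-frozen {P} pr nbrs {v} (moves≡0-seeing-two-colours {P} pr {v} sees)) large))

module BroomProfile {m : ℕ} (T : Graph (suc (suc m))) (s : Fin (suc (suc m)) → Bool) (tree : IsTree T) (sides : ProperSides T s)
  (3≤m : 3 ≤ m)
  (u mid w : Fin (suc (suc m))) (u≢w : u ≢ w) (u-mid : Adj T u mid) (mid-w : Adj T mid w)
  (mid-nbrs : ∀ y → Adj T mid y → y ≡ u ⊎ y ≡ w)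
  (leaves : ∀ x → x ≢ u → x ≢ mid → x ≢ w →
     (Adj T x u × (∀ y → Adj T x y → y ≡ u)) ⊎ (Adj T x w × (∀ y → Adj T x y → y ≡ w)))
  (ℓ : Fin (suc (suc m))) (ℓ-w : Adj T ℓ w) (ℓ-leaf : ∀ y → Adj T ℓ y → y ≡ w) where

  open Degrees T
  open Classes T s tree sides using (class; ∣_∣; class⇒; nbrs; conn; ∣∣-compl)
  open Classes.DoubleBroom T s tree sides u mid w u≢w u-mid mid-w mid-nbrs leaves using (sw≡su; other-class; ∣not-su∣≡m)

  P₀ : Col N
  P₀ = bipartition s

  P₀-proper : Proper T P₀
  P₀-proper = bipartition-Proper s T sides

  u≢mid : u ≢ mid
  u≢mid = Adj⇒≢ T u-mid

  mid≢w : mid ≢ w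
  mid≢w = Adj⇒≢ T mid-w

  ℓ≢w : ℓ ≢ w
  ℓ≢w = Adj⇒≢ T ℓ-w

  ℓ≢u : ℓ ≢ u
  ℓ≢u ℓ≡u = sides u w (subst (λ x → Adj T x w) ℓ≡u ℓ-w) (sym sw≡su)

  ℓ≢mid : ℓ ≢ mid
  ℓ≢mid ℓ≡mid = u≢w (ℓ-leaf u (subst (λ x → Adj T x u) (sym ℓ≡mid) (Adj-sym T u-mid)))

  P₀u≡P₀w : P₀ u ≡ P₀ w
  P₀u≡P₀w = from (bipartition-≡⇔ s u w) (sym sw≡su)

  P₀mid≢P₀u : P₀ mid ≢ P₀ u
  P₀mid≢P₀u = sides mid u (Adj-sym T u-mid) ∘ to (bipartition-≡⇔ s mid u)

  P₀-other : ∀ x → x ≢ u → x ≢ w → P₀ x ≡ P₀ mid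
  P₀-other x x≢u x≢w = from (bipartition-≡⇔ s x mid) (≢-≢⇒≡ (other-class x x≢u x≢w) (other-class mid (u≢mid ∘ sym) mid≢w))

  other-class-large : ∀ y → y ≢ u → y ≢ w → 3 ≤ ∣ s y ∣
  other-class-large y y≢u y≢w = subst (λ b → 3 ≤ ∣ b ∣) (sym (BoolP.¬-not (other-class y y≢u y≢w)))
                                      (≤-trans 3≤m (≤-reflexive (sym ∣not-su∣≡m)))

  same-class-avoiding : ∀ y → y ≢ u → y ≢ w → ∀ x → ∃ λ z → z ≢ y × z ≢ x × P₀ z ≡ P₀ y
  same-class-avoiding y y≢u y≢w x = pick (#-avoiding (class (s y)) (y ∷ x ∷ []) (other-class-large y y≢u y≢w))
    where
    pick : (∃ λ z → class (s y) z ≡ true × All (z ≢_) (y ∷ x ∷ [])) → ∃ λ z → z ≢ y × z ≢ x × P₀ z ≡ P₀ y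
    pick (z , z∈ , z≢y ∷ z≢x ∷ []) = z , z≢y , z≢x , from (bipartition-≡⇔ s z y) (class⇒ {s y} z∈)

  -- Isolating w or isolating u in the bipartition gives the same partition.
  ≋∖w⇒≋∖u : ∀ {Q} → Proper T Q → P₀ ≋ Q ∖ w → P₀ ≋ Q ∖ u
  ≋∖w⇒≋∖u {Q} prQ ≋∖w x y x≢u y≢u with x Fin.≟ w | y Fin.≟ w
  ... | no x≢w | no y≢w = ≋∖w x y x≢w y≢w
  ... | yes refl | yes refl = mk⇔ (λ _ → refl) (λ _ → refl)
  ... | yes refl | no y≢w = mk⇔ (⊥-elim ∘ P₀w≢ y y≢u y≢w) (⊥-elim ∘ Qw≢ y y≢u y≢w ∘ sym)
    where
    P₀w≢ : ∀ y → y ≢ u → y ≢ w → P₀ w ≢ P₀ y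
    P₀w≢ y y≢u y≢w P₀w≡P₀y = P₀mid≢P₀u (trans (sym (P₀-other y y≢u y≢w)) (trans (sym P₀w≡P₀y) (sym P₀u≡P₀w)))
    Qw≢ : ∀ y → y ≢ u → y ≢ w → Q y ≢ Q w
    Qw≢ y y≢u y≢w Qy≡Qw = prQ mid w mid-w (trans (to (≋∖w mid y mid≢w y≢w) (sym (P₀-other y y≢u y≢w))) Qy≡Qw)
  ... | no x≢w | yes refl = mk⇔ (⊥-elim ∘ P₀w≢ ∘ sym) (⊥-elim ∘ Qw≢)
    where
    P₀w≢ : P₀ w ≢ P₀ x
    P₀w≢ P₀w≡P₀x = P₀mid≢P₀u (trans (sym (P₀-other x x≢u x≢w)) (trans (sym P₀w≡P₀x) (sym P₀u≡P₀w)))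
    Qw≢ : Q x ≢ Q w
    Qw≢ Qx≡Qw = prQ mid w mid-w (trans (to (≋∖w mid x mid≢w x≢w) (sym (P₀-other x x≢u x≢w))) Qx≡Qw)

  deg-P₀≤ : deg P₀ ≤ suc m
  deg-P₀≤ = ≤-pred (begin
    suc (deg P₀)          ≡⟨ +-comm 1 (deg P₀) ⟩
    deg P₀ + 1            ≡⟨ cong (deg P₀ +_) (sym (#-point w)) ⟩
    deg P₀ + # (_==F w)   ≤⟨ deg-bound {P₀} P₀-proper nbrs (_==F w) witness ⟩
    N ∎)
    where
    open ≤-Reasoning
    witness : ∀ Q → neighbourᵇ P₀ Q ≡ true → ∃ λ v → (v ==F w) ≡ false × sameMinus v P₀ Q ≡ true
    witness Q e = redirect (proj₂ (bellAdj⇒BellAdj P₀ Q (∧-true₂ {stableᵇ T Q} e)))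
      where
      redirect : (∃ λ v → P₀ ≋ Q ∖ v) → ∃ λ v → (v ==F w) ≡ false × sameMinus v P₀ Q ≡ true
      redirect (v , ≋∖v) = by-cases (v Fin.≟ w)
        where
        by-cases : Dec (v ≡ w) → ∃ λ v → (v ==F w) ≡ false × sameMinus v P₀ Q ≡ true
        by-cases (no v≢w) = v , ≢⇒==F-false v≢w , ≋∖⇒sameMinus P₀ Q v ≋∖v
        by-cases (yes refl) = u , ≢⇒==F-false u≢w ,
          ≋∖⇒sameMinus P₀ Q u (≋∖w⇒≋∖u (properB⇒Proper T Q (∧-true₁ (∧-true₁ {stableᵇ T Q} e))) ≋∖v)

  deg≤ : ∀ {P} → Proper T P → IsCanonical P → deg P ≤ suc m
  deg≤ {P} pr can = [ frozen , (λ P≋P₀ → ≤-trans (≤-reflexive (deg-resp-≋ P≋P₀)) deg-P₀≤) ]′ (dichotomy T s conn sides pr can)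
    where
    frozen : (∃ λ v → SeesTwoColours T P v) → deg P ≤ suc m
    frozen (v , sees) = ≤-pred (one-frozen {P} pr nbrs {v} (moves≡0-seeing-two-colours {P} pr {v} sees))

  deg-P₀≥ : suc m ≤ deg P₀
  deg-P₀≥ = LowerBound.m≤deg {P₀} P₀-proper (punchIn w) (λ _ → 2F) (punchIn-injective w)
              (λ j → bipartition-≢2F s (punchIn w j) ∘ sym) (λ j x _ → bipartition-≢2F s x) separated
    where
    separated : ∀ i j → ∃ λ z → z ≢ punchIn w i × z ≢ punchIn w j × (P₀ z ≡ P₀ (punchIn w i) ⊎ P₀ z ≡ 2F)
    separated i j = pick (punchIn w i Fin.≟ u)
      where
      pick : Dec (punchIn w i ≡ u) → ∃ λ z → z ≢ punchIn w i × z ≢ punchIn w j × (P₀ z ≡ P₀ (punchIn w i) ⊎ P₀ z ≡ 2F)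
      pick (yes i≡u) = w , punchInᵢ≢i w i ∘ sym , punchInᵢ≢i w j ∘ sym , inj₁ (trans (sym P₀u≡P₀w) (cong P₀ (sym i≡u)))
      pick (no i≢u) = let (z , z≢i , z≢j , same) = same-class-avoiding (punchIn w i) i≢u (punchInᵢ≢i w i) (punchIn w j)
                      in z , z≢i , z≢j , inj₁ same

  P₁ : Col N
  P₁ = P₀ [ ℓ ≔ 2F ]

  P₁-proper : Proper T P₁
  P₁-proper = Proper-≔ P₀ ℓ 2F P₀-proper (λ x _ → bipartition-≢2F s x)

  P₁-off : ∀ x → x ≢ ℓ → P₁ x ≡ P₀ x
  P₁-off = ≔-off P₀ ℓ 2F

  ¬P₀≋P₁ : ¬ (P₀ ≋ P₁)
  ¬P₀≋P₁ P₀≋P₁ = bipartition-≢2F s mid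
    (trans (sym (P₁-off mid (ℓ≢mid ∘ sym))) (sym (trans (sym (≔-at P₀ ℓ 2F)) (to (P₀≋P₁ ℓ mid) (P₀-other ℓ ℓ≢u ℓ≢w)))))

  deg-P₁≥ : suc m ≤ deg P₁
  deg-P₁≥ = LowerBound.m≤deg {P₁} P₁-proper ι col (punchIn-injective w) changes legal separated
    where
    ι : Fin (suc m) → Fin N
    ι = punchIn w
    ι≢w : ∀ j → ι j ≢ w
    ι≢w j = punchInᵢ≢i w j
    col : Fin (suc m) → Fin 3
    col j = if ι j ==F ℓ then P₀ ℓ else 2F
    col-ℓ : ∀ j → ι j ≡ ℓ → col j ≡ P₀ ℓ
    col-ℓ j e = cong (λ b → if b then P₀ ℓ else 2F) (trans (cong (_==F ℓ) e) (==F-refl ℓ))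
    col-off : ∀ j → ι j ≢ ℓ → col j ≡ 2F
    col-off j ne = cong (λ b → if b then P₀ ℓ else 2F) (≢⇒==F-false ne)
    changes : ∀ j → col j ≢ P₁ (ι j)
    changes j = by-cases (ι j Fin.≟ ℓ)
      where
      by-cases : Dec (ι j ≡ ℓ) → col j ≢ P₁ (ι j)
      by-cases (yes e) c≡ = bipartition-≢2F s ℓ (trans (sym (col-ℓ j e)) (trans c≡ (trans (cong P₁ e) (≔-at P₀ ℓ 2F))))
      by-cases (no ne) c≡ = bipartition-≢2F s (ι j) (trans (sym (P₁-off (ι j) ne)) (trans (sym c≡) (col-off j ne)))
    legal : ∀ j x → Adj T (ι j) x → P₁ x ≢ col j
    legal j x jx = by-cases (ι j Fin.≟ ℓ)
      where
      by-cases : Dec (ι j ≡ ℓ) → P₁ x ≢ col j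
      by-cases (yes e) c≡ =
        let x≡w = ℓ-leaf x (subst (λ y → Adj T y x) e jx)
            x≢ℓ = λ x≡ℓ → ℓ≢w (trans (sym x≡ℓ) x≡w)
        in P₀mid≢P₀u (trans (sym (P₀-other ℓ ℓ≢u ℓ≢w))
             (trans (sym (col-ℓ j e)) (trans (sym c≡) (trans (P₁-off x x≢ℓ) (trans (cong P₀ x≡w) (sym P₀u≡P₀w))))))
      by-cases (no ne) c≡ =
        let x≢ℓ = λ x≡ℓ → ι≢w j (ℓ-leaf (ι j) (Adj-sym T (subst (Adj T (ι j)) x≡ℓ jx)))
        in bipartition-≢2F s x (trans (sym (P₁-off x x≢ℓ)) (trans c≡ (col-off j ne)))
    separated : ∀ i j → ∃ λ z → z ≢ ι i × z ≢ ι j × (P₁ z ≡ P₁ (ι i) ⊎ P₁ z ≡ col i)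
    separated i j = by-cases (ι i Fin.≟ ℓ) (ι i Fin.≟ u) (ι j Fin.≟ ℓ)
      where
      Goal = ∃ λ z → z ≢ ι i × z ≢ ι j × (P₁ z ≡ P₁ (ι i) ⊎ P₁ z ≡ col i)
      by-cases : Dec (ι i ≡ ℓ) → Dec (ι i ≡ u) → Dec (ι j ≡ ℓ) → Goal
      by-cases (yes i≡ℓ) _ _ = let (z , z≢ℓ , z≢j , same) = same-class-avoiding ℓ ℓ≢u ℓ≢w (ι j) in
        z , (λ z≡i → z≢ℓ (trans z≡i i≡ℓ)) , z≢j , inj₂ (trans (P₁-off z z≢ℓ) (trans same (sym (col-ℓ i i≡ℓ))))
      by-cases (no i≢ℓ) (yes i≡u) _ = w , ι≢w i ∘ sym , ι≢w j ∘ sym ,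
        inj₁ (trans (P₁-off w (ℓ≢w ∘ sym)) (trans (sym P₀u≡P₀w) (trans (cong P₀ (sym i≡u)) (sym (P₁-off (ι i) i≢ℓ)))))
      by-cases (no i≢ℓ) (no i≢u) (no j≢ℓ) = ℓ , i≢ℓ ∘ sym , j≢ℓ ∘ sym , inj₂ (trans (≔-at P₀ ℓ 2F) (sym (col-off i i≢ℓ)))
      by-cases (no i≢ℓ) (no i≢u) (yes j≡ℓ) = let (z , z≢i , z≢ℓ , same) = same-class-avoiding (ι i) i≢u (ι≢w i) ℓ in
        z , z≢i , (λ z≡j → z≢ℓ (trans z≡j j≡ℓ)) , inj₁ (trans (P₁-off z z≢ℓ) (trans same (sym (P₁-off (ι i) i≢ℓ))))

  P₂ : Col N
  P₂ = P₁ [ u ≔ 2F ]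

  P₂-proper : Proper T P₂
  P₂-proper = Proper-≔ P₁ u 2F P₁-proper legal
    where
    legal : ∀ x → Adj T u x → P₁ x ≢ 2F
    legal x ux P₁x≡2 = bipartition-≢2F s x (trans (sym (P₁-off x x≢ℓ)) P₁x≡2)
      where
      x≢ℓ : x ≢ ℓ
      x≢ℓ x≡ℓ = u≢w (ℓ-leaf u (Adj-sym T (subst (Adj T u) x≡ℓ ux)))

  P₂-off : ∀ x → x ≢ u → x ≢ ℓ → P₂ x ≡ P₀ x
  P₂-off x x≢u x≢ℓ = trans (≔-off P₁ u 2F x x≢u) (P₁-off x x≢ℓ)

  deg-P₂≤ : deg P₂ ≤ m
  deg-P₂≤ = ≤-pred (≤-pred (two-frozen {P₂} P₂-proper nbrs {w} {mid} (mid≢w ∘ sym) w-frozen mid-frozen))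
    where
    P₂ℓ≡2 : P₂ ℓ ≡ 2F
    P₂ℓ≡2 = trans (≔-off P₁ u 2F ℓ ℓ≢u) (≔-at P₀ ℓ 2F)
    w-frozen : moves P₂ w ≡ 0
    w-frozen = moves≡0-seeing-two-colours {P₂} P₂-proper {w}
      (mid , ℓ , Adj-sym T mid-w , Adj-sym T ℓ-w ,
       λ P₂mid≡P₂ℓ → bipartition-≢2F s mid (trans (sym (P₂-off mid (u≢mid ∘ sym) (ℓ≢mid ∘ sym))) (trans P₂mid≡P₂ℓ P₂ℓ≡2)))
    mid-frozen : moves P₂ mid ≡ 0
    mid-frozen = moves≡0-seeing-two-colours {P₂} P₂-proper {mid}
      (u , w , Adj-sym T u-mid , mid-w ,
       λ P₂u≡P₂w → bipartition-≢2F s w (trans (sym (P₂-off w (u≢w ∘ sym) (ℓ≢w ∘ sym))) (trans (sym P₂u≡P₂w) (≔-at P₁ u 2F))))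

-- The sorted degree sequence

Descending : List ℕ → Set
Descending = AllPairs _≥_

module _ (M : ℕ) where

  atLeast atMost : ℕ → Bool
  atLeast x = M ≤ᵇ x
  atMost x = x ≤ᵇ M

  atLeast⇒ : ∀ {x} → atLeast x ≡ true → M ≤ x
  atLeast⇒ {x} e = ≤ᵇ⇒≤ M x (from BoolP.T-≡ e)

  ⇒atLeast : ∀ {x} → M ≤ x → atLeast x ≡ true
  ⇒atLeast M≤x = to BoolP.T-≡ (≤⇒≤ᵇ M≤x)

  atMost⇒ : ∀ {x} → atMost x ≡ true → x ≤ M
  atMost⇒ {x} e = ≤ᵇ⇒≤ x M (from BoolP.T-≡ e)

  ⇒atMost : ∀ {x} → x ≤ M → atMost x ≡ true
  ⇒atMost x≤M = to BoolP.T-≡ (≤⇒≤ᵇ x≤M)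

  ≤-bounded-by-head : ∀ {x xs} → All (x ≥_) xs → 1 ≤ tally atLeast xs → M ≤ x
  ≤-bounded-by-head {x} {y ∷ ys} (x≥y ∷ x≥ys) some with atLeast y in e
  ... | true = ≤-trans (atLeast⇒ e) x≥y
  ... | false = ≤-bounded-by-head x≥ys some

  ≤-head : ∀ {x xs} → Descending (x ∷ xs) → 1 ≤ tally atLeast (x ∷ xs) → M ≤ x
  ≤-head {x} (x≥xs ∷ _) some with atLeast x in e
  ... | true = atLeast⇒ e
  ... | false = ≤-bounded-by-head x≥xs some

  ≤-second : ∀ {x y ys} → Descending (x ∷ y ∷ ys) → 2 ≤ tally atLeast (x ∷ y ∷ ys) → M ≤ y
  ≤-second {x} (_ ∷ desc) two = ≤-head desc (+-cancelˡ-≤ 1 _ _ (≤-trans two (+-monoˡ-≤ _ (𝟙≤1 (atLeast x)))))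

  second-< : ∀ {x y ys} → Descending (x ∷ y ∷ ys) → tally atLeast (x ∷ y ∷ ys) ≤ 1 → y < M
  second-< {x} {y} ((x≥y ∷ _) ∷ _) one = ≰⇒> λ M≤y →
    <-irrefl refl (≤-trans (+-mono-≤ (≤-reflexive (cong 𝟙 (sym (⇒atLeast (≤-trans M≤y x≥y)))))
                                     (≤-trans (≤-reflexive (cong 𝟙 (sym (⇒atLeast M≤y)))) (m≤m+n _ _))) one)

  atLeast-false : ∀ {x} → x < M → atLeast x ≡ false
  atLeast-false x<M = ¬true⇒false (λ e → <-irrefl refl (<-≤-trans x<M (atLeast⇒ e)))

  head-< : ∀ {x xs} → tally atLeast (x ∷ xs) ≡ 0 → x < M
  head-< {x} none with atLeast x in e
  ... | false = ≰⇒> (λ M≤x → true≢false (⇒atLeast M≤x) e)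

  last-≤ : ∀ {x xs} → Descending (x ∷ xs) → 1 ≤ tally atMost (x ∷ xs) → nth (x ∷ xs) (suc (length xs)) ≤ M
  last-≤ {x} {[]} _ some with atMost x in e
  ... | true = atMost⇒ e
  last-≤ {x} {y ∷ ys} ((x≥y ∷ _) ∷ desc) some = last-≤ {y} {ys} desc tail-some
    where
    tail-some : 1 ≤ tally atMost (y ∷ ys)
    tail-some with atMost x in e
    ... | true = ≤-trans (≤-reflexive (cong 𝟙 (sym (⇒atMost (≤-trans x≥y (atMost⇒ e)))))) (m≤m+n _ _)
    ... | false = some

  ≤-last : ∀ {x xs} → tally atLeast (x ∷ xs) ≡ suc (length xs) → M ≤ nth (x ∷ xs) (suc (length xs))
  ≤-last {x} {[]} all with atLeast x in e
  ... | true = atLeast⇒ e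
  ≤-last {x} {y ∷ ys} all with atLeast x in e
  ... | true = ≤-last {y} {ys} (suc-injective all)
  ... | false = ⊥-elim (<-irrefl refl (≤-trans (≤-reflexive (sym all)) (tally-≤-length atLeast (y ∷ ys))))

last-≤-second : ∀ {x y ys} → Descending (x ∷ y ∷ ys) → nth (x ∷ y ∷ ys) (suc (suc (length ys))) ≤ y
last-≤-second {y = y} (_ ∷ desc) = last-≤ y desc (≤-trans (≤-reflexive (cong 𝟙 (sym (⇒atMost y ≤-refl)))) (m≤m+n _ _))

second-≤-head : ∀ {x y ys} → Descending (x ∷ y ∷ ys) → y ≤ x
second-≤-head ((x≥y ∷ _) ∷ _) = x≥y

Descending-reverseAcc : ∀ acc xs → AllPairs _≤_ xs → Descending acc → All (λ a → All (a ≤_) xs) acc →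
  Descending (List.reverseAcc acc xs)
Descending-reverseAcc acc [] _ desc _ = desc
Descending-reverseAcc acc (x ∷ xs) (x≤xs ∷ asc) desc acc≤ =
  Descending-reverseAcc (x ∷ acc) xs asc (All.map (λ { (a≤x ∷ _) → a≤x }) acc≤ ∷ desc) (x≤xs ∷ All.map (λ { (_ ∷ a≤xs) → a≤xs }) acc≤)

tally-↭ : ∀ {A : Set} (q : A → Bool) {xs ys} → xs ↭ ys → tally q xs ≡ tally q ys
tally-↭ q {xs} {ys} xs↭ys =
  trans (sym (length-filter≡tally q xs)) (trans (↭-length (filter-↭ (λ x → q x Bool.≟ true) xs↭ys)) (length-filter≡tally q ys))

module DegreeSequence {m : ℕ} (T : Graph (suc (suc m))) (tree : IsTree T) where

  open Degrees T

  degrees : List ℕ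
  degrees = map (bellDegree T) (stablePartitions T)

  descending : Descending (degreeSequence T)
  descending = Descending-reverseAcc [] (sort degrees) (Linked⇒AllPairs ≤-trans (sort-↗ degrees)) [] []

  tally-degreeSequence : ∀ q → tally q (degreeSequence T) ≡ #Col N (λ P → stableᵇ T P ∧ q (deg P))
  tally-degreeSequence q = begin
    tally q (degreeSequence T)                               ≡⟨ tally-↭ q (↭-trans (↭-reverse (sort degrees)) (sort-↭ degrees)) ⟩
    tally q degrees                                          ≡⟨ tally-map q (bellDegree T) (stablePartitions T) ⟩
    tally (q ∘ bellDegree T) (stablePartitions T)            ≡⟨ tally-filter (stableᵇ T) (q ∘ bellDegree T) (allCols N) ⟩
    #Col N (λ P → stableᵇ T P ∧ q (bellDegree T P))          ≡⟨ #Col-cong N (λ P → cong (λ k → stableᵇ T P ∧ q k) (bellDegree≡deg P)) ⟩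
    #Col N (λ P → stableᵇ T P ∧ q (deg P)) ∎
    where open ≡-Reasoning

  length-degreeSequence : length (degreeSequence T) ≡ #Col N (stableᵇ T)
  length-degreeSequence = begin
    length (degreeSequence T)      ≡⟨ ↭-length (↭-trans (↭-reverse (sort degrees)) (sort-↭ degrees)) ⟩
    length degrees                 ≡⟨ ListP.length-map (bellDegree T) (stablePartitions T) ⟩
    length (stablePartitions T)    ≡⟨ length-filter≡tally (stableᵇ T) (allCols N) ⟩
    #Col N (stableᵇ T) ∎
    where open ≡-Reasoning

record Extremes (xs : List ℕ) : Set where
  field
    second≤first : nth xs 2 ≤ nth xs 1
    last≤second : nth xs (length xs) ≤ nth xs 2
    ≤first : ∀ M → 1 ≤ tally (atLeast M) xs → M ≤ nth xs 1
    first< : ∀ M → tally (atLeast M) xs ≡ 0 → nth xs 1 < M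
    ≤second : ∀ M → 2 ≤ tally (atLeast M) xs → M ≤ nth xs 2
    second< : ∀ M → tally (atLeast M) xs ≤ 1 → nth xs 2 < M
    last≤ : ∀ M → 1 ≤ tally (atMost M) xs → nth xs (length xs) ≤ M
    ≤last : ∀ M → tally (atLeast M) xs ≡ length xs → M ≤ nth xs (length xs)

extremes : ∀ {xs} → Descending xs → 2 ≤ length xs → Extremes xs
extremes {x ∷ y ∷ ys} desc _ = record
  { second≤first = second-≤-head desc
  ; last≤second = last-≤-second desc
  ; ≤first = λ M → ≤-head M desc
  ; first< = λ M → head-< M {x} {y ∷ ys}
  ; ≤second = λ M → ≤-second M desc
  ; second< = λ M → second-< M desc
  ; last≤ = λ M → last-≤ M {x} {y ∷ ys} desc
  ; ≤last = λ M → ≤-last M {x} {y ∷ ys}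
  }
extremes {_ ∷ []} _ (s≤s ())

module Patterns {m : ℕ} (T : Graph (suc (suc m))) (s : Fin (suc (suc m)) → Bool) (tree : IsTree T) (sides : ProperSides T s)
  (4≤m : 4 ≤ m) where

  open Degrees T
  open DegreeSequence T tree
  open Classes T s tree sides using (nbrs; IsStar⇒smallClass≡1)

  private
    xs : List ℕ
    xs = degreeSequence T

    2≤m : 2 ≤ m
    2≤m = ≤-trans (s≤s (s≤s z≤n)) 4≤m

    length≡2^m : length xs ≡ 2 ^ m
    length≡2^m = trans length-degreeSequence (#stable-tree T tree)

    2≤length : 2 ≤ length xs
    2≤length = ≤-trans (≤-trans (s≤s (s≤s z≤n)) (^-monoʳ-≤ 2 (≤-trans (s≤s z≤n) 2≤m))) (≤-reflexive (sym length≡2^m))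

    stable : ∀ {P} → Proper T P → IsCanonical P → stableᵇ T P ≡ true
    stable {P} pr can = ∧-intro (Proper⇒properB T P pr) (from (canonical⇔IsCanonical P) can)

    unstable : ∀ {P} → stableᵇ T P ≡ true → Proper T P × IsCanonical P
    unstable {P} e = properB⇒Proper T P (∧-true₁ e) , to (canonical⇔IsCanonical P) (∧-true₂ {properB T P} e)

    Extensional-degree : ∀ q → Extensional (λ P → stableᵇ T P ∧ q (deg P))
    Extensional-degree q e = cong₂ _∧_ (Extensional-stableᵇ e) (cong q (deg-resp-≋ (≗⇒≋ e)))

    attained : ∀ q {P} → Proper T P → IsCanonical P → q (deg P) ≡ true → 1 ≤ tally q xs
    attained q {P} pr can qP = subst (1 ≤_) (sym (tally-degreeSequence q))
                                 (#Col-pos N _ (Extensional-degree q) P (∧-intro (stable pr can) qP))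

    never : ∀ q → (∀ {P} → Proper T P → IsCanonical P → q (deg P) ≡ false) → tally q xs ≡ 0
    never q h = trans (tally-degreeSequence q) (#Col-none N _ (λ P → none P))
      where
      none : ∀ P → (stableᵇ T P ∧ q (deg P)) ≡ false
      none P = ¬true⇒false (λ e → let (pr , can) = unstable {P} (∧-true₁ {stableᵇ T P} e) in
                                   true≢false (∧-true₂ {stableᵇ T P} e) (h {P} pr can))

    always : ∀ q → (∀ {P} → Proper T P → IsCanonical P → q (deg P) ≡ true) → tally q xs ≡ length xs
    always q h = trans (tally-degreeSequence q) (trans (#Col-cong N every) (sym length-degreeSequence))
      where
      every : ∀ P → (stableᵇ T P ∧ q (deg P)) ≡ stableᵇ T P
      every P = ∧-absorbʳ-under (λ e → let (pr , can) = unstable {P} e in h {P} pr can)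

  open Extremes (extremes descending 2≤length)

  d₁ d₂ dₗ : ℕ
  d₁ = d T 1
  d₂ = d T 2
  dₗ = d T (2 ^ m)

  last≡dₗ : nth xs (length xs) ≡ dₗ
  last≡dₗ = cong (nth xs) length≡2^m

  d₂≤d₁ : d₂ ≤ d₁
  d₂≤d₁ = second≤first

  dₗ≤d₂ : dₗ ≤ d₂
  dₗ≤d₂ = subst (_≤ d₂) last≡dₗ last≤second

  star-pattern : IsStar T → d₁ ≡ dₗ
  star-pattern (c , centre) =
    ≤-antisym (≤-trans (≤-pred (first< (suc (suc m)) (never (atLeast (suc (suc m))) too-large)))
                       (subst (suc m ≤_) last≡dₗ (≤last (suc m) (always (atLeast (suc m)) large))))
              (≤-trans dₗ≤d₂ d₂≤d₁)
    where
    open StarProfile T tree c centre using (deg≡)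
    too-large : ∀ {P} → Proper T P → IsCanonical P → atLeast (suc (suc m)) (deg P) ≡ false
    too-large {P} pr _ = atLeast-false (suc (suc m)) (≤-reflexive (cong suc (deg≡ 2≤m {P} pr)))
    large : ∀ {P} → Proper T P → IsCanonical P → atLeast (suc m) (deg P) ≡ true
    large {P} pr _ = ⇒atLeast (suc m) (≤-reflexive (sym (deg≡ 2≤m {P} pr)))

  big-pattern : 3 ≤ smallClass s → d₂ < d₁
  big-pattern big = <-≤-trans (second< N at-most-one)
                              (≤first N (attained (atLeast N) {P₀} P₀-proper (bipartition-IsCanonical s) (⇒atLeast N deg-P₀)))
    where
    open BigProfile T s tree sides big using (P₀; deg-P₀; maximum-unique)
    P₀-proper : Proper T P₀
    P₀-proper = bipartition-Proper s T sides
    unique : ∀ P P′ → (stableᵇ T P ∧ atLeast N (deg P)) ≡ true → (stableᵇ T P′ ∧ atLeast N (deg P′)) ≡ true → P ≗ P′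
    unique P P′ e e′ i =
      let (pr , can) = unstable {P} (∧-true₁ {stableᵇ T P} e)
          (pr′ , can′) = unstable {P′} (∧-true₁ {stableᵇ T P′} e′)
      in trans (maximum-unique {P} pr can (atLeast⇒ N (∧-true₂ {stableᵇ T P} e)) i)
               (sym (maximum-unique {P′} pr′ can′ (atLeast⇒ N (∧-true₂ {stableᵇ T P′} e′)) i))
    at-most-one : tally (atLeast N) xs ≤ 1
    at-most-one = subst (_≤ 1) (sym (tally-degreeSequence (atLeast N))) (#Col-≤1 N _ (Extensional-degree (atLeast N)) unique)

  private
    V : Set
    V = Fin N

    3≤m : 3 ≤ m
    3≤m = ≤-trans (n≤1+n 3) 4≤m

  broom-pattern-at : ∀ (u mid w : V) → u ≢ w → Adj T u mid → Adj T mid w → (∀ y → Adj T mid y → y ≡ u ⊎ y ≡ w) →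
    (∀ x → x ≢ u → x ≢ mid → x ≢ w → (Adj T x u × (∀ y → Adj T x y → y ≡ u)) ⊎ (Adj T x w × (∀ y → Adj T x y → y ≡ w))) →
    ∀ ℓ → Adj T ℓ w → (∀ y → Adj T ℓ y → y ≡ w) → d₁ ≡ d₂ × dₗ < d₂
  broom-pattern-at u mid w u≢w u-mid mid-w mid-nbrs leaves ℓ ℓ-w ℓ-leaf =
    ≤-antisym (≤-trans d₁≤ ≤d₂) d₂≤d₁ , <-≤-trans (s≤s dₗ≤) ≤d₂
    where
    open BroomProfile T s tree sides 3≤m u mid w u≢w u-mid mid-w mid-nbrs leaves ℓ ℓ-w ℓ-leaf
      using (P₀; P₁; P₂; P₀-proper; P₁-proper; P₂-proper; deg≤; deg-P₀≥; deg-P₁≥; deg-P₂≤; ¬P₀≋P₁)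
    d₁≤ : d₁ ≤ suc m
    d₁≤ = ≤-pred (first< (suc (suc m)) (never (atLeast (suc (suc m))) (λ {P} pr can → atLeast-false (suc (suc m)) (s≤s (deg≤ {P} pr can)))))
    g : Fin 2 → Col N
    g 0F = P₀
    g 1F = normalise P₁
    good : ∀ j → (stableᵇ T (g j) ∧ atLeast (suc m) (deg (g j))) ≡ true
    good 0F = ∧-intro (stable {P₀} P₀-proper (bipartition-IsCanonical s)) (⇒atLeast (suc m) deg-P₀≥)
    good 1F = ∧-intro (stable {normalise P₁} (Proper-resp-≋ T (normalise-≋ P₁) P₁-proper) (normalise-IsCanonical P₁))
                      (⇒atLeast (suc m) (≤-trans deg-P₁≥ (≤-reflexive (deg-resp-≋ (normalise-≋ P₁)))))
    distinct : ∀ i j → g i ≗ g j → i ≡ j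
    distinct 0F 0F _ = refl
    distinct 1F 1F _ = refl
    distinct 0F 1F e = ⊥-elim (¬P₀≋P₁ (≋-trans (≗⇒≋ e) (≋-sym (normalise-≋ P₁))))
    distinct 1F 0F e = ⊥-elim (¬P₀≋P₁ (≋-trans (≗⇒≋ (sym ∘ e)) (≋-sym (normalise-≋ P₁))))
    ≤d₂ : suc m ≤ d₂
    ≤d₂ = ≤second (suc m) (subst (2 ≤_) (sym (tally-degreeSequence (atLeast (suc m))))
                                 (#Col-≥ N 2 _ (Extensional-degree (atLeast (suc m))) g good distinct))
    dₗ≤ : dₗ ≤ m
    dₗ≤ = subst (_≤ m) last≡dₗ (last≤ m (attained (atMost m) {normalise P₂} (Proper-resp-≋ T (normalise-≋ P₂) P₂-proper)
                            (normalise-IsCanonical P₂) (⇒atMost m (≤-trans (≤-reflexive (deg-resp-≋ (≋-sym (normalise-≋ P₂)))) deg-P₂≤))))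

  broom-pattern : IsDoubleBroom T → d₁ ≡ d₂ × dₗ < d₂
  broom-pattern (u , mid , w , u≢w , u-mid , mid-w , mid-nbrs , leaves) =
    pick (#-avoiding (λ _ → true) (u ∷ mid ∷ w ∷ []) (≤-trans (s≤s (s≤s 2≤m)) (≤-reflexive (sym (sum-ones N)))))
    where
    swap : ∀ {A B : Set} → A ⊎ B → B ⊎ A
    swap = [ inj₂ , inj₁ ]′
    pick : (∃ λ x → true ≡ true × All (x ≢_) (u ∷ mid ∷ w ∷ [])) → d₁ ≡ d₂ × dₗ < d₂
    pick (x , _ , x≢u ∷ x≢mid ∷ x≢w ∷ []) with leaves x x≢u x≢mid x≢w
    ... | inj₂ (x-w , x-leaf) = broom-pattern-at u mid w u≢w u-mid mid-w mid-nbrs leaves x x-w x-leaf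
    ... | inj₁ (x-u , x-leaf) =
      broom-pattern-at w mid u (u≢w ∘ sym) (Adj-sym T mid-w) (Adj-sym T u-mid) (λ y → swap ∘ mid-nbrs y)
                       (λ y y≢w y≢mid y≢u → swap (leaves y y≢u y≢mid y≢w)) x x-u x-leaf

classify : ∀ {A B : Set} {k d₁ d₂ dₗ : ℕ} → dₗ ≤ d₂ → d₂ ≤ d₁ → 1 ≤ k →
  (A → k ≡ 1) → (k ≡ 1 → A × d₁ ≡ dₗ) → (B → k ≡ 2) → (k ≡ 2 → B × d₁ ≡ d₂ × dₗ < d₂) → (3 ≤ k → d₂ < d₁) →
  (A ⇔ (d₁ ≡ dₗ)) × (B ⇔ ((d₁ ≡ d₂) × (d₂ > dₗ))) × ((3 ≤ k) ⇔ (d₁ > d₂))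
classify {k = 1} dₗ≤d₂ d₂≤d₁ _ _ one two _ _ =
  let (a , d₁≡dₗ) = one refl in
  mk⇔ (λ _ → d₁≡dₗ) (λ _ → a) ,
  mk⇔ (λ b → case two b of λ ()) (λ (_ , dₗ<d₂) → ⊥-elim (<⇒≱ dₗ<d₂ (≤-trans d₂≤d₁ (≤-reflexive d₁≡dₗ)))) ,
  mk⇔ (λ { (s≤s ()) }) (λ d₂<d₁ → ⊥-elim (<⇒≱ d₂<d₁ (≤-trans (≤-reflexive d₁≡dₗ) dₗ≤d₂)))
classify {k = 2} dₗ≤d₂ d₂≤d₁ _ one _ _ two _ =
  let (b , d₁≡d₂ , dₗ<d₂) = two refl in
  mk⇔ (λ a → case one a of λ ()) (λ d₁≡dₗ → ⊥-elim (<⇒≱ dₗ<d₂ (≤-trans d₂≤d₁ (≤-reflexive d₁≡dₗ)))) ,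
  mk⇔ (λ _ → d₁≡d₂ , dₗ<d₂) (λ _ → b) ,
  mk⇔ (λ { (s≤s (s≤s ())) }) (λ d₂<d₁ → ⊥-elim (<-irrefl (sym d₁≡d₂) d₂<d₁))
classify {k = suc (suc (suc k))} dₗ≤d₂ d₂≤d₁ _ one _ two _ three =
  let d₂<d₁ = three (s≤s (s≤s (s≤s z≤n))) in
  mk⇔ (λ a → case one a of λ ()) (λ d₁≡dₗ → ⊥-elim (<⇒≱ d₂<d₁ (≤-trans (≤-reflexive d₁≡dₗ) dₗ≤d₂))) ,
  mk⇔ (λ b → case two b of λ ()) (λ (d₁≡d₂ , _) → ⊥-elim (<-irrefl (sym d₁≡d₂) d₂<d₁)) ,
  mk⇔ (λ _ → d₂<d₁) (λ _ → s≤s (s≤s (s≤s z≤n)))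

lemma5p4 : ∀ (n : ℕ) (T : Graph n) (s : Fin n → Bool) → 6 ≤ n → IsTree T → ProperSides T s →
    (IsStar T ⇔ (d T 1 ≡ d T (2 ^ (n ∸ 2)))) ×
    (IsDoubleBroom T ⇔ ((d T 1 ≡ d T 2) × (d T 2 > d T (2 ^ (n ∸ 2))))) ×
    ((3 ≤ smallClass s) ⇔ (d T 1 > d T 2))
lemma5p4 (suc (suc m)) T s (s≤s (s≤s 4≤m)) tree sides =
  classify dₗ≤d₂ d₂≤d₁ smallClass≥1
    IsStar⇒smallClass≡1 (λ k≡1 → let star = smallClass≡1⇒IsStar k≡1 in star , star-pattern star)
    (IsDoubleBroom⇒smallClass≡2 (≤-trans (s≤s (s≤s z≤n)) 4≤m))
    (λ k≡2 → let broom = smallClass≡2⇒IsDoubleBroom k≡2 in broom , broom-pattern broom)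
    big-pattern
  where
  open Classes T s tree sides
  open Patterns T s tree sides 4≤m
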